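{- Let $n\ge2$ and let $\zeta_n$ be a primitive $n$-th root of unity. Then: (i) for all $w,w'\in\widehat{\mathfrak H^1}$, $z_n(w*_q w')=z_n(w)z_n(w')$; (ii) let $\psi:\widehat{\mathfrak H^1}\to\widehat{\mathfrak H^1}$ be the $\mathcal C$-algebra anti-involution with $\psi(e_{\overline1})=-e_1$, $\psi(e_1)=-e_{\overline1}$, and $\psi(e_k)=(-1)^k\sum_{j=2}^k\binom{k-2}{j-2}\hbar^{k-j}e_j$ for $k\ge2$. Then for all $w,w'\in\widehat{\mathfrak H^1}$, $z_n(w\sqcup\!\sqcup_q w')=z_n(\psi(w)w')$.
   Context: Let $\hbar$ be a formal variable, $\mathcal{C}=\mathbb{Q}[\hbar,\hbar^{ -1}]$, and $\mathfrak{H}=\mathcal{C}\langle \mathbf{a},\mathbf{b}\rangle$ the non-commutative polynomial ring over $\mathcal{C}$. Let $\widehat{\mathbb{N}}=\{\overline{1}\}\sqcup\mathbb{N}$, $\overline1$ a new symbol. Put $e_{\overline{1}}=\mathbf{a}\mathbf{b}$ and $e_k=\mathbf{a}^{k-1}(\mathbf{a}+\hbar)\mathbf{b}$ for $k\ge 1$. Let $\widehat{\mathfrak{H}^1}$ be the $\mathcal{C}$-subalgebra generated freely by $\{e_k\}_{k\in\widehat{\mathbb{N}}}$; an index is a tuple $\mathbf k=(k_1,\dots,k_r)$, $r\ge0$, of elements of $\widehat{\mathbb N}$, $e_{\mathbf k}=e_{k_1}\cdots e_{k_r}$, $e_\emptyset=1$, and $\{e_{\mathbf k}\}$ over all indices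 is a $\mathcal C$-basis of $\widehat{\mathfrak H^1}$. Stuffle product: let $\mathfrak{z}$ be the $\mathcal{C}$-span of $\{e_k\}$ and $\circ_q$ the symmetric $\mathcal{C}$-bilinear map with $e_{\overline1}\circ_q e_{\overline1}=e_2-\hbar e_{\overline1}$, $e_{\overline1}\circ_q e_k=e_{k+1}$, $e_k\circ_q e_l=e_{k+l}+\hbar e_{k+l-1}$ ($k,l\ge1$). $*_q$ is the $\mathcal{C}$-bilinear product on $\widehat{\mathfrak{H}^1}$ with $1*_q w=w*_q1=w$ and $(e_kw)*_q(e_lw')=e_k(w*_q e_lw')+e_l(e_kw*_q w')+(e_k\circ_q e_l)(w*_q w')$. Shuffle product: $\sqcup\!\sqcup_q$ is the $\mathcal{C}$-bilinear product on $\mathfrak H$ with $1\sqcup\!\sqcup_q w=w\sqcup\!\sqcup_q 1=w$, $(\mathbf a w)\sqcup\!\sqcup_q(\mathbf a w')=\mathbf a\big((\mathbf a w)\sqcup\!\sqcup_q w'+w\sqcup\!\sqcup_q(\mathbf a w')+\hbar\, w\sqcup\!\sqcup_q w'\big)$, $(\mathbf b w)\sqcup\!\sqcup_q w'=w\sqcup\!\sqcup_q(\mathbf b w')=\mathbf b(w\sqcup\!\sqcup_q w')$; $\widehat{\mathfrak H^1}$ is closed under it. For $m\ge1$ let $[m]=(1-q^m)/(1-q)$, $F_{\overline1}(m)=q^m/[m]$, $F_k(m)=q^{(k-1)m}/[m]^k$ ($k\ge1$). For an index $\mathbf k=(k_1,\dots,k_r)$ put $z_n(\mathbf k;\zeta_n)=\sum_{n>m_1>\cdots>m_r\ge1}\prod_{j=1}^rF_{k_j}(m_j)\big|_{q=\zeta_n}$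 (empty sum $=0$ if $r\ge n$; $z_n(\emptyset;\zeta_n)=1$). Regard $\mathbb C$ as a $\mathcal C$-module with $\hbar$ acting as multiplication by $1-\zeta_n$, and let $z_n:\widehat{\mathfrak H^1}\to\mathbb C$ be the $\mathcal C$-linear map with $z_n(e_{\mathbf k})=z_n(\mathbf k;\zeta_n)$ for every index $\mathbf k$. -}

module Defs where

open import Level using (Level; _⊔_) renaming (suc to lsuc)
open import Data.Nat as ℕ using (ℕ; zero; suc)
open import Data.Nat.Combinatorics using (_C_)
open import Data.Integer as ℤ using (ℤ; +_; -[1+_])
open import Data.Rational as ℚ using (ℚ; ↥_; ↧ₙ_)
open import Data.Product using (_×_; _,_)
open import Data.List using (List; []; _∷_; _++_; map; concatMap)
open import Data.Bool using (true; false; if_then_else_)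
open import Relation.Nullary using (¬_)
open import Algebra.Bundles using (CommutativeRing)

record Field (c ℓ : Level) : Set (lsuc (c ⊔ ℓ)) where
  field
    commutativeRing : CommutativeRing c ℓ
  open CommutativeRing commutativeRing public
  field
    _⁻¹      : Carrier → Carrier
    ⁻¹-cong  : ∀ {x y} → x ≈ y → x ⁻¹ ≈ y ⁻¹
    ⁻¹-inverse : ∀ x → ¬ (x ≈ 0#) → x * (x ⁻¹) ≈ 1#
    0≉1      : ¬ (0# ≈ 1#)

-- Formal C-linear combinations, C = ℚ[ħ, ħ⁻¹].
-- A term (c , j , x) stands for  c ħ^j x  (c ∈ ℚ, j ∈ ℤ).
-- An element of a free C-module with basis X is represented by a list of
-- terms (their sum).  All maps below are defined on basis elements and
-- extended C-(bi)linearly, so they are well defined on the module.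

Term : Set → Set
Term X = ℚ × ℤ × X

Lin : Set → Set
Lin X = List (Term X)

⟪_⟫ : ∀ {X} → X → Lin X
⟪ x ⟫ = (ℚ.1ℚ , + 0 , x) ∷ []

scale : ∀ {X} → ℚ → ℤ → Lin X → Lin X
scale c j = map (λ { (d , i , x) → (c ℚ.* d , j ℤ.+ i , x) })

ext : ∀ {X Y} → (X → Lin Y) → Lin X → Lin Y
ext f = concatMap (λ { (c , j , x) → scale c j (f x) })

ext2 : ∀ {X Y Z} → (X → Y → Lin Z) → Lin X → Lin Y → Lin Z
ext2 f u v = ext (λ x → ext (λ y → f x y) v) u

prefix : ∀ {A} → A → Lin (List A) → Lin (List A)
prefix a = map (λ { (c , j , w) → (c , j , a ∷ w) })

_·_ : ∀ {A} → Lin (List A) → Lin (List A) → Lin (List A)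
_·_ = ext2 (λ u v → ⟪ u ++ v ⟫)

-- The algebra  Ĥ¹ = C⟨ e_k | k ∈ ℕ̂ ⟩.
-- ℕ̂ = {1̄} ⊔ ℕ_{≥1}.  'one-bar' is 1̄, and  'nat k'  is the positive
-- integer  k + 1  (so  e (nat k) = e_{k+1}).

data ℕ̂ : Set where
  one-bar : ℕ̂
  nat     : ℕ → ℕ̂

-- indices; e_𝐤 = e_{k₁}⋯e_{k_r} is the word 𝐤 in the letters e_k
Index : Set
Index = List ℕ̂

Ĥ¹ : Set
Ĥ¹ = Lin Index

e : ℕ̂ → Ĥ¹
e k = ⟪ k ∷ [] ⟫

_∘q_ : ℕ̂ → ℕ̂ → Lin ℕ̂
one-bar ∘q one-bar = (ℚ.1ℚ , + 0 , nat 1) ∷ (ℚ.- ℚ.1ℚ , + 1 , one-bar) ∷ []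
one-bar ∘q nat l   = ⟪ nat (suc l) ⟫
nat k   ∘q one-bar = ⟪ nat (suc k) ⟫
nat k   ∘q nat l   = (ℚ.1ℚ , + 0 , nat (suc (k ℕ.+ l))) ∷ (ℚ.1ℚ , + 1 , nat (k ℕ.+ l)) ∷ []

stuffleW : Index → Index → Ĥ¹
stuffleW []      w'       = ⟪ w' ⟫
stuffleW (k ∷ w) []       = ⟪ k ∷ w ⟫
stuffleW (k ∷ w) (l ∷ w') =
  prefix k (stuffleW w (l ∷ w'))
  ++ prefix l (stuffleW (k ∷ w) w')
  ++ ext (λ m → prefix m r) (k ∘q l)
  where r = stuffleW w w'

_*q_ : Ĥ¹ → Ĥ¹ → Ĥ¹
_*q_ = ext2 stuffleW

data AB : Set where
  a b : AB

𝔥 : Set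
𝔥 = Lin (List AB)

shuffleW : List AB → List AB → 𝔥
shuffleW []       w'        = ⟪ w' ⟫
shuffleW (b ∷ w)  w'        = prefix b (shuffleW w w')
shuffleW (a ∷ w)  []        = ⟪ a ∷ w ⟫
shuffleW (a ∷ w)  (b ∷ w')  = prefix b (shuffleW (a ∷ w) w')
shuffleW (a ∷ w)  (a ∷ w')  =
  prefix a (shuffleW (a ∷ w) w' ++ shuffleW w (a ∷ w') ++ scale ℚ.1ℚ (+ 1) (shuffleW w w'))

_⧢q_ : 𝔥 → 𝔥 → 𝔥
_⧢q_ = ext2 shuffleW

aʷ : ℕ → List AB
aʷ zero    = []
aʷ (suc k) = a ∷ aʷ k

letterIn𝔥 : ℕ̂ → 𝔥
letterIn𝔥 one-bar = ⟪ a ∷ b ∷ [] ⟫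
letterIn𝔥 (nat k) = (ℚ.1ℚ , + 0 , aʷ (suc k) ++ b ∷ []) ∷ (ℚ.1ℚ , + 1 , aʷ k ++ b ∷ []) ∷ []

wordIn𝔥 : Index → 𝔥
wordIn𝔥 []      = ⟪ [] ⟫
wordIn𝔥 (k ∷ w) = letterIn𝔥 k · wordIn𝔥 w

ι : Ĥ¹ → 𝔥
ι = ext wordIn𝔥

-- Inverse direction: the expansion in the basis {e_𝐤} of an element of
-- 𝔥 lying in Ĥ¹ (= C ⊕ 𝔥b).  The word a^k b is
--   k = 0 :  b       = ħ⁻¹ (e_1 − e_1̄)
--   k = 1 :  ab      = e_1̄
--   k ≥ 2 :  a^k b   = e_k − ħ a^{k−1} b
blockÊ : ℕ → Lin ℕ̂
blockÊ zero          = (ℚ.1ℚ , -[1+ 0 ] , nat 0) ∷ (ℚ.- ℚ.1ℚ , -[1+ 0 ] , one-bar) ∷ []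
blockÊ (suc zero)    = ⟪ one-bar ⟫
blockÊ (suc (suc k)) = ⟪ nat (suc k) ⟫ ++ scale (ℚ.- ℚ.1ℚ) (+ 1) (blockÊ (suc k))

-- expansion of a word a^{k} w (k = number of pending a's).  Words with a
-- trailing a (not in Ĥ¹) are sent to 0; they never occur below, since
-- Ĥ¹ is closed under ⧢_q.
expandW : ℕ → List AB → Ĥ¹
expandW zero    []      = ⟪ [] ⟫
expandW (suc k) []      = []
expandW k       (a ∷ w) = expandW (suc k) w
expandW k       (b ∷ w) = ext (λ m → prefix m (expandW 0 w)) (blockÊ k)

to-Ĥ¹ : 𝔥 → Ĥ¹
to-Ĥ¹ = ext (expandW 0)

_⧢Ĥ_ : Ĥ¹ → Ĥ¹ → Ĥ¹
w ⧢Ĥ w' = to-Ĥ¹ (ι w ⧢q ι w')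

signℚ : ℕ → ℚ
signℚ zero    = ℚ.1ℚ
signℚ (suc k) = ℚ.- signℚ k

ℕ→ℚ : ℕ → ℚ
ℕ→ℚ m = ℚ._/_ (+ m) 1

-- Σ_{i=0}^{t} binom(k,i) ħ^{k−i} e_{i+2},  here  k = (K − 2), j = i + 2
ψsum : ℕ → ℕ → Lin ℕ̂
ψsum k zero    = (signℚ k ℚ.* ℕ→ℚ (k C 0) , + k , nat 1) ∷ []
ψsum k (suc t) = (signℚ k ℚ.* ℕ→ℚ (k C suc t) , + (k ℕ.∸ suc t) , nat (suc (suc t))) ∷ ψsum k t

ψletter : ℕ̂ → Lin ℕ̂
ψletter one-bar       = (ℚ.- ℚ.1ℚ , + 0 , nat 0) ∷ []
ψletter (nat zero)    = (ℚ.- ℚ.1ℚ , + 0 , one-bar) ∷ []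
ψletter (nat (suc k)) = ψsum k k   -- e_{k+2}; sign (−1)^{k+2} = (−1)^k

ψword : Index → Ĥ¹
ψword []      = ⟪ [] ⟫
ψword (k ∷ w) = ψword w · ext (λ m → ⟪ m ∷ [] ⟫) (ψletter k)

ψ : Ĥ¹ → Ĥ¹
ψ = ext ψword

module Values {c ℓ : Level} (F : Field c ℓ) where
  open Field F

  ℕ→F : ℕ → Carrier
  ℕ→F zero    = 0#
  ℕ→F (suc m) = 1# + ℕ→F m

  ℤ→F : ℤ → Carrier
  ℤ→F (+ m)      = ℕ→F m
  ℤ→F -[1+ m ]   = - ℕ→F (suc m)

  ℚ→F : ℚ → Carrier
  ℚ→F r = ℤ→F (↥ r) * (ℕ→F (↧ₙ r) ⁻¹)

  CharZero : Set ℓ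
  CharZero = ∀ m → ¬ (ℕ→F (suc m) ≈ 0#)

  pow : Carrier → ℕ → Carrier
  pow x zero    = 1#
  pow x (suc k) = x * pow x k

  PrimitiveRoot : ℕ → Carrier → Set ℓ
  PrimitiveRoot n ζ = (pow ζ n ≈ 1#) × (∀ k → 1 ℕ.≤ k → k ℕ.< n → ¬ (pow ζ k ≈ 1#))

  module AtRoot (n : ℕ) (ζ : Carrier) where

    ħ : Carrier
    ħ = 1# - ζ

    powℤ : Carrier → ℤ → Carrier
    powℤ x (+ k)    = pow x k
    powℤ x -[1+ k ] = pow (x ⁻¹) (suc k)

    [_] : ℕ → Carrier
    [ m ] = (1# - pow ζ m) * ((1# - ζ) ⁻¹)

    Fk : ℕ̂ → ℕ → Carrier
    Fk one-bar m = pow ζ m * ([ m ] ⁻¹)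
    Fk (nat k) m = pow ζ (k ℕ.* m) * (pow [ m ] (suc k) ⁻¹)

    sumBelow : ℕ → (ℕ → Carrier) → Carrier
    sumBelow zero          f = 0#
    sumBelow (suc zero)    f = 0#
    sumBelow (suc (suc N)) f = f (suc N) + sumBelow (suc N) f

    zsum : ℕ → Index → Carrier
    zsum N []      = 1#
    zsum N (k ∷ 𝐤) = sumBelow N (λ m → Fk k m * zsum m 𝐤)

    zIndex : Index → Carrier
    zIndex = zsum n

    zn : Ĥ¹ → Carrier
    zn []                  = 0#
    zn ((r , j , 𝐤) ∷ rest) = ℚ→F r * powℤ ħ j * zIndex 𝐤 + zn rest

-- z_n(𝐤) is a nested sum Σ_{n > m₁ > ⋯ > m_r ≥ 1} Π F_{k_j}(m_j), and *_q is exactly the recursion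
-- obtained by splitting off the largest summation index, once one knows F_k(m) F_l(m) = F_{k ∘_q l}(m).
-- For ⧢_q, words in a and b are evaluated directly: every b opens a new summation index and every a
-- contributes x(m) = F_1̄(m) = q^m/[m] at it; on Ĥ¹ this agrees with z_n.  The aa-rule of ⧢_q then
-- becomes x(m) x(p) = x(m + p) (x(m) + x(p) + ħ), whence z_N(u ⧢_q v) = Σ_m Z_m(u) z_{N−m}(v).
-- At N = n the substitution m ↦ n − m, via ζ^n = 1 and [n − m] = −ζ^{n−m} [m], rewrites F_k(n − m)
-- as the ψ(e_k)-combination of the F_j(m) (a binomial expansion of (x(m) + ħ)^{k−2}); this is (ii).

module Submission where

open import Defs
open import Level using (Level)
open import Data.Nat as ℕ using (ℕ; zero; suc; z≤n; s≤s; _≤_)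
import Data.Nat.Properties as ℕP
open import Data.Integer as ℤ using (ℤ; +_; -[1+_]; _⊖_; _◃_)
import Data.Integer.Properties as ℤP
import Data.Integer.GCD as ℤ
open import Data.Sign as Sign using (Sign)
import Data.Rational as ℚ
import Data.Rational.Properties as ℚP
open import Data.Nat.Combinatorics using (_C_)
open import Data.Fin using (toℕ; inject₁; fromℕ)
open import Data.Fin.Properties using (toℕ-inject₁; toℕ-fromℕ)
open import Data.Maybe using (Maybe; just; nothing)
open import Data.Product using (_×_; _,_; proj₁; proj₂)
open import Data.List using (List; []; _∷_; _++_)
import Data.List.Properties as LP
open import Relation.Nullary using (¬_; yes; no)
open import Relation.Binary.PropositionalEquality as ≡ using (_≡_)
open import Algebra.Solver.Ring.AlmostCommutativeRing using (fromCommutativeRing; _-Raw-AlmostCommutative⟶_)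
import Algebra.Solver.Ring

module FieldArithmetic {c ℓ : Level} (F : Field c ℓ) where
  open Field F public
  open Values F public
  open import Relation.Binary.Reasoning.Setoid setoid public
  open import Algebra.Properties.Ring ring public
    using (-‿distribˡ-*; -‿involutive; -0#≈0#; -1*x≈-x)
  open import Algebra.Properties.AbelianGroup +-abelianGroup using (⁻¹-∙-comm)
  open import Algebra.Properties.CommutativeSemigroup +-commutativeSemigroup
    using (x∙yz≈y∙xz) renaming (interchange to +-interchange)
  open import Algebra.Properties.CommutativeSemigroup *-commutativeSemigroup public
    using () renaming (interchange to *-interchange)
  open import Algebra.Properties.Semiring.Mult semiring public
    using (×-homo-+; ×1-homo-*; ×-assoc-*; ×-congʳ) renaming (_×_ to _×ᴺ_)
  open import Algebra.Properties.Semiring.Sum semiring public using (sum-cong-≗; sum-init-last; sum⁺-syntax)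
  open import Algebra.Properties.Semiring.Exp semiring public using (_^_; ^-congˡ; ^-homo-*; ^-assocʳ)
  open import Algebra.Properties.CommutativeSemiring.Exp commutativeSemiring public using (^-distrib-*)
  open import Algebra.Properties.CommutativeSemiring.Binomial commutativeSemiring public
    using (binomialExpansion) renaming (theorem to binomial-theorem)

  ℕ→F≡×1 : ∀ m → ℕ→F m ≡ m ×ᴺ 1#
  ℕ→F≡×1 zero    = ≡.refl
  ℕ→F≡×1 (suc m) = ≡.cong (λ x → 1# + x) (ℕ→F≡×1 m)

  ℕ→F-homo-+ : ∀ m k → ℕ→F (m ℕ.+ k) ≈ ℕ→F m + ℕ→F k
  ℕ→F-homo-+ m k rewrite ℕ→F≡×1 (m ℕ.+ k) | ℕ→F≡×1 m | ℕ→F≡×1 k = ×-homo-+ 1# m k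

  ℕ→F-homo-* : ∀ m k → ℕ→F (m ℕ.* k) ≈ ℕ→F m * ℕ→F k
  ℕ→F-homo-* m k rewrite ℕ→F≡×1 (m ℕ.* k) | ℕ→F≡×1 m | ℕ→F≡×1 k = ×1-homo-* m k

  ℤ→F-⊖ : ∀ m k → ℤ→F (m ⊖ k) ≈ ℕ→F m - ℕ→F k
  ℤ→F-⊖ zero    zero    = sym (trans (+-congˡ -0#≈0#) (+-identityʳ _))
  ℤ→F-⊖ zero    (suc k) = sym (+-identityˡ _)
  ℤ→F-⊖ (suc m) zero    = sym (trans (+-congˡ -0#≈0#) (+-identityʳ _))
  ℤ→F-⊖ (suc m) (suc k) = begin
    ℤ→F (suc m ⊖ suc k)                 ≡⟨ ≡.cong ℤ→F (ℤP.[1+m]⊖[1+n]≡m⊖n m k) ⟩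
    ℤ→F (m ⊖ k)                         ≈⟨ ℤ→F-⊖ m k ⟩
    ℕ→F m - ℕ→F k                       ≈⟨ +-identityˡ _ ⟨
    0# + (ℕ→F m - ℕ→F k)                ≈⟨ +-congʳ (-‿inverseʳ 1#) ⟨
    (1# - 1#) + (ℕ→F m - ℕ→F k)         ≈⟨ +-interchange 1# (- 1#) (ℕ→F m) (- ℕ→F k) ⟩
    (1# + ℕ→F m) + (- 1# - ℕ→F k)       ≈⟨ +-congˡ (⁻¹-∙-comm 1# (ℕ→F k)) ⟩
    (1# + ℕ→F m) - (1# + ℕ→F k)         ∎

  ℤ→F-homo-+ : ∀ i j → ℤ→F (i ℤ.+ j) ≈ ℤ→F i + ℤ→F j
  ℤ→F-homo-+ -[1+ m ] -[1+ k ] = begin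
    - (1# + ℕ→F (suc (m ℕ.+ k)))         ≈⟨ -‿cong (+-congˡ (ℕ→F-homo-+ (suc m) k)) ⟩
    - (1# + (ℕ→F (suc m) + ℕ→F k))       ≈⟨ -‿cong (x∙yz≈y∙xz 1# (ℕ→F (suc m)) (ℕ→F k)) ⟩
    - (ℕ→F (suc m) + ℕ→F (suc k))        ≈⟨ ⁻¹-∙-comm _ _ ⟨
    - ℕ→F (suc m) - ℕ→F (suc k)          ∎
  ℤ→F-homo-+ -[1+ m ] (+ k)    = trans (ℤ→F-⊖ k (suc m)) (+-comm _ _)
  ℤ→F-homo-+ (+ m)    -[1+ k ] = ℤ→F-⊖ m (suc k)
  ℤ→F-homo-+ (+ m)    (+ k)    = ℕ→F-homo-+ m k

  ℤ→F-homo-‿ : ∀ i → ℤ→F (ℤ.- i) ≈ - ℤ→F i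
  ℤ→F-homo-‿ -[1+ m ]    = sym (-‿involutive _)
  ℤ→F-homo-‿ (+ zero)    = sym -0#≈0#
  ℤ→F-homo-‿ (+ suc m)   = refl

  signToF : Sign → Carrier
  signToF Sign.+ = 1#
  signToF Sign.- = - 1#

  signToF-homo-* : ∀ s t → signToF (s Sign.* t) ≈ signToF s * signToF t
  signToF-homo-* Sign.+ t      = sym (*-identityˡ _)
  signToF-homo-* Sign.- Sign.+ = sym (*-identityʳ _)
  signToF-homo-* Sign.- Sign.- = sym (trans (-1*x≈-x (- 1#)) (-‿involutive 1#))

  ℤ→F-◃ : ∀ s k → ℤ→F (s ◃ k) ≈ signToF s * ℕ→F k
  ℤ→F-◃ s      zero    = sym (zeroʳ _)
  ℤ→F-◃ Sign.+ (suc k) = sym (*-identityˡ _)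
  ℤ→F-◃ Sign.- (suc k) = sym (-1*x≈-x _)

  ℤ→F-sign-abs : ∀ i → ℤ→F i ≈ signToF (ℤ.sign i) * ℕ→F ℤ.∣ i ∣
  ℤ→F-sign-abs (+ k)    = sym (*-identityˡ _)
  ℤ→F-sign-abs -[1+ k ] = sym (-1*x≈-x _)

  ℤ→F-homo-* : ∀ i j → ℤ→F (i ℤ.* j) ≈ ℤ→F i * ℤ→F j
  ℤ→F-homo-* i j = begin
    ℤ→F (i ℤ.* j)
      ≈⟨ ℤ→F-◃ (ℤ.sign i Sign.* ℤ.sign j) (ℤ.∣ i ∣ ℕ.* ℤ.∣ j ∣) ⟩
    signToF (ℤ.sign i Sign.* ℤ.sign j) * ℕ→F (ℤ.∣ i ∣ ℕ.* ℤ.∣ j ∣)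
      ≈⟨ *-cong (signToF-homo-* (ℤ.sign i) (ℤ.sign j)) (ℕ→F-homo-* ℤ.∣ i ∣ ℤ.∣ j ∣) ⟩
    (signToF (ℤ.sign i) * signToF (ℤ.sign j)) * (ℕ→F ℤ.∣ i ∣ * ℕ→F ℤ.∣ j ∣) ≈⟨ *-interchange _ _ _ _ ⟩
    (signToF (ℤ.sign i) * ℕ→F ℤ.∣ i ∣) * (signToF (ℤ.sign j) * ℕ→F ℤ.∣ j ∣) ≈⟨ *-cong (ℤ→F-sign-abs i) (ℤ→F-sign-abs j) ⟨
    ℤ→F i * ℤ→F j                                                   ∎

  ℤ→F-morphism : ℤ.+-*-rawRing -Raw-AlmostCommutative⟶ fromCommutativeRing commutativeRing
  ℤ→F-morphism = record
    { ⟦_⟧ = ℤ→F ; +-homo = ℤ→F-homo-+ ; *-homo = ℤ→F-homo-* ; -‿homo = ℤ→F-homo-‿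
    ; 0-homo = refl ; 1-homo = +-identityʳ 1# }

  ℤ→F-≟ : ∀ i j → Maybe (ℤ→F i ≈ ℤ→F j)
  ℤ→F-≟ i j with i ℤ.≟ j
  ... | yes ≡.refl = just refl
  ... | no _       = nothing

  module Solver = Algebra.Solver.Ring ℤ.+-*-rawRing (fromCommutativeRing commutativeRing) ℤ→F-morphism ℤ→F-≟
  open Solver public using (solve; _:=_; _:+_; _:*_; _:-_; :-_)

  ⁻¹-inverseˡ : ∀ x → ¬ (x ≈ 0#) → x ⁻¹ * x ≈ 1#
  ⁻¹-inverseˡ x x≉0 = trans (*-comm _ _) (⁻¹-inverse x x≉0)

  x*y≈1⇒x≉0 : ∀ {x y} → x * y ≈ 1# → ¬ (x ≈ 0#)
  x*y≈1⇒x≉0 {x} {y} xy≈1 x≈0 = 0≉1 (trans (sym (trans (*-congʳ x≈0) (zeroˡ y))) xy≈1)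

  *-cancelʳ : ∀ {x y d} → ¬ (d ≈ 0#) → x * d ≈ y * d → x ≈ y
  *-cancelʳ {x} {y} {d} d≉0 xd≈yd = begin
    x                ≈⟨ *-identityʳ x ⟨
    x * 1#           ≈⟨ *-congˡ (⁻¹-inverse d d≉0) ⟨
    x * (d * d ⁻¹)   ≈⟨ *-assoc _ _ _ ⟨
    (x * d) * d ⁻¹   ≈⟨ *-congʳ xd≈yd ⟩
    (y * d) * d ⁻¹   ≈⟨ *-assoc _ _ _ ⟩
    y * (d * d ⁻¹)   ≈⟨ *-congˡ (⁻¹-inverse d d≉0) ⟩
    y * 1#           ≈⟨ *-identityʳ y ⟩
    y                ∎

  ⁻¹-unique : ∀ {x y} → x * y ≈ 1# → y ≈ x ⁻¹
  ⁻¹-unique {x} {y} xy≈1 = *-cancelʳ x≉0 (trans (*-comm y x) (trans xy≈1 (sym (⁻¹-inverseˡ x x≉0))))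
    where x≉0 = x*y≈1⇒x≉0 xy≈1

  *-≉0 : ∀ {x y} → ¬ (x ≈ 0#) → ¬ (y ≈ 0#) → ¬ (x * y ≈ 0#)
  *-≉0 {x} {y} x≉0 y≉0 xy≈0 = y≉0 (*-cancelʳ x≉0 (trans (*-comm y x) (trans xy≈0 (sym (zeroˡ x)))))

  ⁻¹-≉0 : ∀ {x} → ¬ (x ≈ 0#) → ¬ (x ⁻¹ ≈ 0#)
  ⁻¹-≉0 {x} x≉0 = x*y≈1⇒x≉0 (⁻¹-inverseˡ x x≉0)

  ⁻¹-distrib-* : ∀ {x y} → ¬ (x ≈ 0#) → ¬ (y ≈ 0#) → (x * y) ⁻¹ ≈ x ⁻¹ * y ⁻¹
  ⁻¹-distrib-* {x} {y} x≉0 y≉0 = sym (⁻¹-unique (begin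
    (x * y) * (x ⁻¹ * y ⁻¹)    ≈⟨ *-interchange _ _ _ _ ⟩
    (x * x ⁻¹) * (y * y ⁻¹)    ≈⟨ *-cong (⁻¹-inverse x x≉0) (⁻¹-inverse y y≉0) ⟩
    1# * 1#                    ≈⟨ *-identityˡ 1# ⟩
    1#                         ∎))

  1⁻¹≈1 : 1# ⁻¹ ≈ 1#
  1⁻¹≈1 = sym (⁻¹-unique (*-identityʳ 1#))

  x-y≈0⇒x≈y : ∀ {x y} → x - y ≈ 0# → x ≈ y
  x-y≈0⇒x≈y {x} {y} x-y≈0 = begin
    x               ≈⟨ solve 2 (λ x y → x := (x :- y) :+ y) refl x y ⟩
    (x - y) + y     ≈⟨ +-congʳ x-y≈0 ⟩
    0# + y          ≈⟨ +-identityˡ y ⟩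
    y               ∎

  x*[1-y]≈x-x*y : ∀ x y → x * (1# - y) ≈ x - x * y
  x*[1-y]≈x-x*y x y = trans (solve 3 (λ x o y → x :* (o :- y) := x :* o :- x :* y) refl x 1# y) (+-congʳ (*-identityʳ x))

  pow≡^ : ∀ x k → pow x k ≡ x ^ k
  pow≡^ x zero    = ≡.refl
  pow≡^ x (suc k) = ≡.cong (x *_) (pow≡^ x k)

  ^-inverse : ∀ {x} → ¬ (x ≈ 0#) → ∀ k → x ^ k * (x ⁻¹) ^ k ≈ 1#
  ^-inverse x≉0 zero    = *-identityʳ 1#
  ^-inverse {x} x≉0 (suc k) = begin
    (x * x ^ k) * (x ⁻¹ * (x ⁻¹) ^ k)   ≈⟨ *-interchange _ _ _ _ ⟩
    (x * x ⁻¹) * (x ^ k * (x ⁻¹) ^ k)   ≈⟨ *-cong (⁻¹-inverse x x≉0) (^-inverse x≉0 k) ⟩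
    1# * 1#                             ≈⟨ *-identityˡ 1# ⟩
    1#                                  ∎

  ℕ→F-*≈× : ∀ m z → ℕ→F m * z ≈ m ×ᴺ z
  ℕ→F-*≈× m z rewrite ℕ→F≡×1 m = trans (×-assoc-* m 1# z) (×-congʳ m (*-identityˡ z))

  ∑≤-suc : ∀ t (g : ℕ → Carrier) → ∑[ i ≤ suc t ] g (toℕ i) ≈ g (suc t) + ∑[ i ≤ t ] g (toℕ i)
  ∑≤-suc t g = begin
    ∑[ i ≤ suc t ] g (toℕ i)                                  ≈⟨ sum-init-last (λ i → g (toℕ i)) ⟩
    ∑[ i ≤ t ] g (toℕ (inject₁ i)) + g (toℕ (fromℕ (suc t)))
      ≡⟨ ≡.cong₂ _+_ (sum-cong-≗ {suc t} (λ i → ≡.cong g (toℕ-inject₁ i))) (≡.cong g (toℕ-fromℕ (suc t))) ⟩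
    ∑[ i ≤ t ] g (toℕ i) + g (suc t)                          ≈⟨ +-comm _ _ ⟩
    g (suc t) + ∑[ i ≤ t ] g (toℕ i)                          ∎

  -‿^ : ∀ z k → (- z) ^ k ≈ (- 1#) ^ k * z ^ k
  -‿^ z k = trans (^-congˡ k (sym (-1*x≈-x z))) (^-distrib-* (- 1#) z k)

  module CharacteristicZero (char0 : CharZero) where

    -- i / k is normalised by G = gcd i k: numerator * G = i and denominator * G = k.
    ℚ→F-/ : ∀ i k .{{_ : ℕ.NonZero k}} → ℚ→F (i ℚ./ k) ≈ ℤ→F i * ℕ→F k ⁻¹
    ℚ→F-/ i k@(suc k-1) = *-cancelʳ BG≉0 (begin
      (A * B ⁻¹) * (B * G)    ≈⟨ solve 4 (λ a b b⁻¹ g → (a :* b⁻¹) :* (b :* g) := (a :* g) :* (b⁻¹ :* b)) refl A B (B ⁻¹) G ⟩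
      (A * G) * (B ⁻¹ * B)    ≈⟨ *-cong AG≈I (⁻¹-inverseˡ B (char0 (ℚ.ℚ.denominator-1 r))) ⟩
      I * 1#                  ≈⟨ *-congˡ (⁻¹-inverseˡ N (char0 k-1)) ⟨
      I * (N ⁻¹ * N)          ≈⟨ solve 3 (λ i n⁻¹ n → i :* (n⁻¹ :* n) := (i :* n⁻¹) :* n) refl I (N ⁻¹) N ⟩
      (I * N ⁻¹) * N          ≈⟨ *-congˡ BG≈N ⟨
      (I * N ⁻¹) * (B * G)    ∎)
      where
      r = i ℚ./ k
      A = ℤ→F (ℚ.↥ r)
      B = ℕ→F (ℚ.↧ₙ r)
      G = ℤ→F (ℤ.gcd i (+ k))
      I = ℤ→F i
      N = ℕ→F k
      AG≈I : A * G ≈ I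
      AG≈I = trans (sym (ℤ→F-homo-* (ℚ.↥ r) (ℤ.gcd i (+ k)))) (reflexive (≡.cong ℤ→F (ℚP.↥-/ i k)))
      BG≈N : B * G ≈ N
      BG≈N = trans (sym (ℤ→F-homo-* (ℚ.↧ r) (ℤ.gcd i (+ k)))) (reflexive (≡.cong ℤ→F (ℚP.↧-/ i k)))
      BG≉0 : ¬ (B * G ≈ 0#)
      BG≉0 BG≈0 = char0 k-1 (trans (sym BG≈N) BG≈0)

    ℚ→F-homo-* : ∀ p q → ℚ→F (p ℚ.* q) ≈ ℚ→F p * ℚ→F q
    ℚ→F-homo-* p@(ℚ.mkℚ _ _ _) q@(ℚ.mkℚ _ _ _) = begin
      ℚ→F (p ℚ.* q)                                           ≈⟨ ℚ→F-/ (ℚ.↥ p ℤ.* ℚ.↥ q) (ℚ.↧ₙ p ℕ.* ℚ.↧ₙ q) ⟩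
      ℤ→F (ℚ.↥ p ℤ.* ℚ.↥ q) * ℕ→F (ℚ.↧ₙ p ℕ.* ℚ.↧ₙ q) ⁻¹      ≈⟨ *-cong (ℤ→F-homo-* (ℚ.↥ p) (ℚ.↥ q)) ↧-homo ⟩
      (ℤ→F (ℚ.↥ p) * ℤ→F (ℚ.↥ q)) * (ℕ→F (ℚ.↧ₙ p) ⁻¹ * ℕ→F (ℚ.↧ₙ q) ⁻¹) ≈⟨ *-interchange _ _ _ _ ⟩
      ℚ→F p * ℚ→F q                                           ∎
      where
      ↧-homo : ℕ→F (ℚ.↧ₙ p ℕ.* ℚ.↧ₙ q) ⁻¹ ≈ ℕ→F (ℚ.↧ₙ p) ⁻¹ * ℕ→F (ℚ.↧ₙ q) ⁻¹
      ↧-homo = trans (⁻¹-cong (ℕ→F-homo-* (ℚ.↧ₙ p) (ℚ.↧ₙ q)))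
                     (⁻¹-distrib-* (char0 (ℚ.ℚ.denominator-1 p)) (char0 (ℚ.ℚ.denominator-1 q)))

    ℚ→F-1 : ℚ→F ℚ.1ℚ ≈ 1#
    ℚ→F-1 = trans (*-cong (+-identityʳ 1#) (trans (⁻¹-cong (+-identityʳ 1#)) 1⁻¹≈1)) (*-identityˡ 1#)

    ℚ→F-homo-‿ : ∀ p → ℚ→F (ℚ.- p) ≈ - ℚ→F p
    ℚ→F-homo-‿ (ℚ.mkℚ -[1+ m ]  d _) = trans (*-congʳ (sym (-‿involutive _))) (sym (-‿distribˡ-* _ _))
    ℚ→F-homo-‿ (ℚ.mkℚ (+ zero)  d _) = trans (zeroˡ _) (sym (trans (-‿cong (zeroˡ _)) -0#≈0#))
    ℚ→F-homo-‿ (ℚ.mkℚ (+ suc m) d _) = sym (-‿distribˡ-* _ _)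

    ℚ→F-signℚ : ∀ k → ℚ→F (signℚ k) ≈ (- 1#) ^ k
    ℚ→F-signℚ zero    = ℚ→F-1
    ℚ→F-signℚ (suc k) = trans (ℚ→F-homo-‿ (signℚ k)) (trans (-‿cong (ℚ→F-signℚ k)) (sym (-1*x≈-x _)))

    ℚ→F-ℕ→ℚ : ∀ m → ℚ→F (ℕ→ℚ m) ≈ ℕ→F m
    ℚ→F-ℕ→ℚ m = trans (ℚ→F-/ (+ m) 1) (trans (*-congˡ (trans (⁻¹-cong (+-identityʳ 1#)) 1⁻¹≈1)) (*-identityʳ _))

module FiniteSums {c ℓ : Level} (F : Field c ℓ) (n : ℕ) (ζ : Field.Carrier F) where
  open FieldArithmetic F public
  open AtRoot n ζ public

  sumBelow-cong : ∀ N {f g : ℕ → Carrier} → (∀ m → 1 ≤ m → m ℕ.< N → f m ≈ g m) → sumBelow N f ≈ sumBelow N g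
  sumBelow-cong zero          f≈g = refl
  sumBelow-cong (suc zero)    f≈g = refl
  sumBelow-cong (suc (suc N)) f≈g =
    +-cong (f≈g (suc N) (s≤s z≤n) ℕP.≤-refl) (sumBelow-cong (suc N) (λ m 1≤m m<N → f≈g m 1≤m (ℕP.m≤n⇒m≤1+n m<N)))

  sumBelow-cong′ : ∀ N {f g : ℕ → Carrier} → (∀ m → f m ≈ g m) → sumBelow N f ≈ sumBelow N g
  sumBelow-cong′ N f≈g = sumBelow-cong N (λ m _ _ → f≈g m)

  sumBelow-zero : ∀ N → sumBelow N (λ _ → 0#) ≈ 0#
  sumBelow-zero zero          = refl
  sumBelow-zero (suc zero)    = refl
  sumBelow-zero (suc (suc N)) = trans (+-identityˡ _) (sumBelow-zero (suc N))

  sumBelow-distrib-+ : ∀ N (f g : ℕ → Carrier) → sumBelow N (λ m → f m + g m) ≈ sumBelow N f + sumBelow N g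
  sumBelow-distrib-+ zero          f g = sym (+-identityʳ 0#)
  sumBelow-distrib-+ (suc zero)    f g = sym (+-identityʳ 0#)
  sumBelow-distrib-+ (suc (suc N)) f g = trans (+-congˡ (sumBelow-distrib-+ (suc N) f g))
    (solve 4 (λ p q s t → (p :+ q) :+ (s :+ t) := (p :+ s) :+ (q :+ t)) refl _ _ _ _)

  sumBelow-*ˡ : ∀ N k (f : ℕ → Carrier) → sumBelow N (λ m → k * f m) ≈ k * sumBelow N f
  sumBelow-*ˡ zero          k f = sym (zeroʳ k)
  sumBelow-*ˡ (suc zero)    k f = sym (zeroʳ k)
  sumBelow-*ˡ (suc (suc N)) k f = trans (+-congˡ (sumBelow-*ˡ (suc N) k f)) (sym (distribˡ _ _ _))

  sumBelow-*ʳ : ∀ N k (f : ℕ → Carrier) → sumBelow N (λ m → f m * k) ≈ sumBelow N f * k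
  sumBelow-*ʳ N k f = trans (sumBelow-cong′ N (λ m → *-comm _ _)) (trans (sumBelow-*ˡ N k f) (*-comm _ _))

  sumBelow-linear : ∀ N k c (f g h : ℕ → Carrier) →
    k * (sumBelow N f + (sumBelow N g + c * sumBelow N h)) ≈ sumBelow N (λ m → k * (f m + (g m + c * h m)))
  sumBelow-linear N k c f g h = sym (begin
    sumBelow N (λ m → k * (f m + (g m + c * h m)))                 ≈⟨ sumBelow-*ˡ N k _ ⟩
    k * sumBelow N (λ m → f m + (g m + c * h m))                   ≈⟨ *-congˡ (sumBelow-distrib-+ N f _) ⟩
    k * (sumBelow N f + sumBelow N (λ m → g m + c * h m))          ≈⟨ *-congˡ (+-congˡ (sumBelow-distrib-+ N g _)) ⟩
    k * (sumBelow N f + (sumBelow N g + sumBelow N (λ m → c * h m))) ≈⟨ *-congˡ (+-congˡ (+-congˡ (sumBelow-*ˡ N c h))) ⟩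
    k * (sumBelow N f + (sumBelow N g + c * sumBelow N h))         ∎)

  sumBelow-suc : ∀ K (f : ℕ → Carrier) → 1 ≤ K → sumBelow (suc K) f ≈ f K + sumBelow K f
  sumBelow-suc (suc K) f _ = refl

  sumBelow-reverse : ∀ N (f : ℕ → Carrier) → sumBelow N f ≈ sumBelow N (λ l → f (N ℕ.∸ l))
  sumBelow-reverse zero          f = refl
  sumBelow-reverse (suc zero)    f = refl
  sumBelow-reverse (suc (suc K)) f =
    trans (+-congˡ (sumBelow-reverse (suc K) f)) (sym (peel-first K (λ l → f (suc (suc K) ℕ.∸ l))))
    where
    peel-first : ∀ K (g : ℕ → Carrier) → sumBelow (suc (suc K)) g ≈ g 1 + sumBelow (suc K) (λ m → g (suc m))
    peel-first zero    g = refl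
    peel-first (suc K) g = trans (+-congˡ (peel-first K g)) (solve 3 (λ p q r → p :+ (q :+ r) := q :+ (p :+ r)) refl _ _ _)

  -- Both sides sum g m s over 1 ≤ m < s < N; on the right s is written p + m.
  sumBelow-triangle : ∀ N (g : ℕ → ℕ → Carrier) →
    sumBelow N (λ s → sumBelow s (λ m → g m s)) ≈ sumBelow N (λ m → sumBelow (N ℕ.∸ m) (λ p → g m (p ℕ.+ m)))
  sumBelow-triangle zero          g = refl
  sumBelow-triangle (suc zero)    g = refl
  sumBelow-triangle (suc (suc K)) g = begin
    sumBelow M (λ m → g m M) + sumBelow M (λ s → sumBelow s (λ m → g m s)) ≈⟨ +-congˡ (sumBelow-triangle (suc K) g) ⟩
    sumBelow M (λ m → g m M) + sumBelow M (λ m → sumBelow (M ℕ.∸ m) (G m))  ≈⟨ sumBelow-distrib-+ M _ _ ⟨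
    sumBelow M (λ m → g m M + sumBelow (M ℕ.∸ m) (G m))                       ≈⟨ sumBelow-cong M column ⟩
    sumBelow M h                                                              ≈⟨ +-identityˡ _ ⟨
    0# + sumBelow M h
      ≈⟨ +-congʳ (reflexive (≡.cong (λ t → sumBelow t (G M)) (ℕP.m+n∸n≡m 1 M))) ⟨
    h M + sumBelow M h                                                        ∎
    where
    M = suc K
    G : ℕ → ℕ → Carrier
    G m p = g m (p ℕ.+ m)
    h : ℕ → Carrier
    h m = sumBelow (suc M ℕ.∸ m) (G m)
    column : ∀ m → 1 ≤ m → m ℕ.< M → g m M + sumBelow (M ℕ.∸ m) (G m) ≈ h m
    column m _ m<M = begin
      g m M + sumBelow (M ℕ.∸ m) (G m)
        ≡⟨ ≡.cong (λ t → g m t + sumBelow (M ℕ.∸ m) (G m)) (ℕP.m∸n+n≡m (ℕP.<⇒≤ m<M)) ⟨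
      G m (M ℕ.∸ m) + sumBelow (M ℕ.∸ m) (G m)      ≈⟨ sumBelow-suc (M ℕ.∸ m) (G m) (ℕP.m<n⇒0<n∸m m<M) ⟨
      sumBelow (suc (M ℕ.∸ m)) (G m)                ≡⟨ ≡.cong (λ t → sumBelow t (G m)) (ℕP.+-∸-assoc 1 (ℕP.<⇒≤ m<M)) ⟨
      h m                                           ∎

  sumBelow-Cauchy : ∀ N (U V : ℕ → Carrier) →
    sumBelow N (λ s → sumBelow s (λ m → U m * V (s ℕ.∸ m))) ≈ sumBelow N (λ m → U m * sumBelow (N ℕ.∸ m) V)
  sumBelow-Cauchy N U V = begin
    sumBelow N (λ s → sumBelow s (λ m → U m * V (s ℕ.∸ m)))
      ≈⟨ sumBelow-triangle N (λ m s → U m * V (s ℕ.∸ m)) ⟩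
    sumBelow N (λ m → sumBelow (N ℕ.∸ m) (λ p → U m * V ((p ℕ.+ m) ℕ.∸ m)))
      ≈⟨ sumBelow-cong′ N (λ m → sumBelow-cong′ (N ℕ.∸ m) (λ p → *-congˡ (reflexive (≡.cong V (ℕP.m+n∸n≡m p m))))) ⟩
    sumBelow N (λ m → sumBelow (N ℕ.∸ m) (λ p → U m * V p))
      ≈⟨ sumBelow-cong′ N (λ m → sumBelow-*ˡ (N ℕ.∸ m) (U m) V) ⟩
    sumBelow N (λ m → U m * sumBelow (N ℕ.∸ m) V)                            ∎

  sumBelow-exchange : ∀ N (A H : ℕ → Carrier) →
    sumBelow N (λ i → A i * sumBelow (N ℕ.∸ i) H) ≈ sumBelow N (λ m → sumBelow m A * H (N ℕ.∸ m))
  sumBelow-exchange N A H = sym (begin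
    sumBelow N (λ m → sumBelow m A * H (N ℕ.∸ m))
      ≈⟨ sumBelow-cong′ N (λ m → sumBelow-*ʳ m (H (N ℕ.∸ m)) A) ⟨
    sumBelow N (λ m → sumBelow m (λ i → A i * H (N ℕ.∸ m)))
      ≈⟨ sumBelow-triangle N (λ i m → A i * H (N ℕ.∸ m)) ⟩
    sumBelow N (λ i → sumBelow (N ℕ.∸ i) (λ p → A i * H (N ℕ.∸ (p ℕ.+ i))))
      ≈⟨ sumBelow-cong′ N (λ i → sumBelow-*ˡ (N ℕ.∸ i) (A i) _) ⟩
    sumBelow N (λ i → A i * sumBelow (N ℕ.∸ i) (λ p → H (N ℕ.∸ (p ℕ.+ i))))
      ≈⟨ sumBelow-cong′ N (λ i → *-congˡ (reversed i)) ⟨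
    sumBelow N (λ i → A i * sumBelow (N ℕ.∸ i) H)                               ∎)
    where
    reversed : ∀ i → sumBelow (N ℕ.∸ i) H ≈ sumBelow (N ℕ.∸ i) (λ p → H (N ℕ.∸ (p ℕ.+ i)))
    reversed i = trans (sumBelow-reverse (N ℕ.∸ i) H) (sumBelow-cong′ (N ℕ.∸ i)
      (λ p → reflexive (≡.cong H (≡.trans (ℕP.∸-+-assoc N i p) (≡.cong (N ℕ.∸_) (ℕP.+-comm i p))))))

module LinearEvaluation {c ℓ : Level} (F : Field c ℓ) (char0 : Values.CharZero F) (n : ℕ) (ζ : Field.Carrier F)
                        (ħ≉0 : ¬ Field._≈_ F (Values.AtRoot.ħ F n ζ) (Field.0# F)) where
  open FiniteSums F n ζ public
  open CharacteristicZero char0 public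

  coef : ℚ.ℚ → ℤ → Carrier
  coef r j = ℚ→F r * powℤ ħ j

  eval : ∀ {X : Set} → (X → Carrier) → Lin X → Carrier
  eval f []                  = 0#
  eval f ((r , j , x) ∷ L) = coef r j * f x + eval f L

  zn≡eval : ∀ L → zn L ≡ eval zIndex L
  zn≡eval []                  = ≡.refl
  zn≡eval ((r , j , x) ∷ L) = ≡.cong (λ t → coef r j * zIndex x + t) (zn≡eval L)

  coef-1ℚ : ∀ j → coef ℚ.1ℚ j ≈ powℤ ħ j
  coef-1ℚ j = trans (*-congʳ ℚ→F-1) (*-identityˡ _)

  coef-‿1ℚ : ∀ j → coef (ℚ.- ℚ.1ℚ) j ≈ - powℤ ħ j
  coef-‿1ℚ j = trans (*-congʳ (trans (ℚ→F-homo-‿ ℚ.1ℚ) (-‿cong ℚ→F-1))) (-1*x≈-x _)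

  powℤ-homo-+ : ∀ {x} → ¬ (x ≈ 0#) → ∀ i j → powℤ x (i ℤ.+ j) ≈ powℤ x i * powℤ x j
  powℤ-homo-+ {x} x≉0 = homo
    where
    pow≈^ : ∀ y k → pow y k ≈ y ^ k
    pow≈^ y k = reflexive (pow≡^ y k)
    ⊖-pow : ∀ m k → powℤ x (m ⊖ k) ≈ pow x m * pow (x ⁻¹) k
    ⊖-pow m       zero    = sym (*-identityʳ _)
    ⊖-pow zero    (suc k) = sym (*-identityˡ _)
    ⊖-pow (suc m) (suc k) = begin
      powℤ x (suc m ⊖ suc k)                     ≡⟨ ≡.cong (powℤ x) (ℤP.[1+m]⊖[1+n]≡m⊖n m k) ⟩
      powℤ x (m ⊖ k)                             ≈⟨ ⊖-pow m k ⟩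
      pow x m * pow (x ⁻¹) k                     ≈⟨ *-identityˡ _ ⟨
      1# * (pow x m * pow (x ⁻¹) k)              ≈⟨ *-congʳ (⁻¹-inverse x x≉0) ⟨
      (x * x ⁻¹) * (pow x m * pow (x ⁻¹) k)      ≈⟨ *-interchange _ _ _ _ ⟩
      (x * pow x m) * (x ⁻¹ * pow (x ⁻¹) k)      ∎
    pow-+ : ∀ y i j → pow y (i ℕ.+ j) ≈ pow y i * pow y j
    pow-+ y i j = trans (pow≈^ y (i ℕ.+ j)) (trans (^-homo-* y i j) (sym (*-cong (pow≈^ y i) (pow≈^ y j))))
    homo : ∀ i j → powℤ x (i ℤ.+ j) ≈ powℤ x i * powℤ x j
    homo -[1+ m ] -[1+ k ] = trans (reflexive (≡.cong (λ t → pow (x ⁻¹) (suc t)) (≡.sym (ℕP.+-suc m k))))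
                                   (pow-+ (x ⁻¹) (suc m) (suc k))
    homo -[1+ m ] (+ k)    = trans (⊖-pow k (suc m)) (*-comm _ _)
    homo (+ m)    -[1+ k ] = ⊖-pow m (suc k)
    homo (+ m)    (+ k)    = pow-+ x m k

  coef-homo-* : ∀ r j s i → coef (r ℚ.* s) (j ℤ.+ i) ≈ coef r j * coef s i
  coef-homo-* r j s i = trans (*-cong (ℚ→F-homo-* r s) (powℤ-homo-+ ħ≉0 j i)) (*-interchange _ _ _ _)

  module _ {X : Set} where
    eval-cong : ∀ {f g : X → Carrier} → (∀ x → f x ≈ g x) → ∀ L → eval f L ≈ eval g L
    eval-cong f≈g []                  = refl
    eval-cong f≈g ((r , j , x) ∷ L) = +-cong (*-congˡ (f≈g x)) (eval-cong f≈g L)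

    eval-++ : ∀ (f : X → Carrier) L M → eval f (L ++ M) ≈ eval f L + eval f M
    eval-++ f []                  M = sym (+-identityˡ _)
    eval-++ f ((r , j , x) ∷ L) M = trans (+-congˡ (eval-++ f L M)) (sym (+-assoc _ _ _))

    eval-zero : ∀ L → eval {X} (λ _ → 0#) L ≈ 0#
    eval-zero []                  = refl
    eval-zero ((r , j , x) ∷ L) = trans (+-cong (zeroʳ _) (eval-zero L)) (+-identityʳ 0#)

    eval-distrib-+ : ∀ (f g : X → Carrier) L → eval (λ x → f x + g x) L ≈ eval f L + eval g L
    eval-distrib-+ f g []                  = sym (+-identityʳ 0#)
    eval-distrib-+ f g ((r , j , x) ∷ L) = trans (+-cong (distribˡ _ _ _) (eval-distrib-+ f g L))
      (solve 4 (λ p q s t → (p :+ q) :+ (s :+ t) := (p :+ s) :+ (q :+ t)) refl _ _ _ _)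

    eval-*ˡ : ∀ k (f : X → Carrier) L → eval (λ x → k * f x) L ≈ k * eval f L
    eval-*ˡ k f []                  = sym (zeroʳ k)
    eval-*ˡ k f ((r , j , x) ∷ L) =
      trans (+-cong (solve 3 (λ k c y → c :* (k :* y) := k :* (c :* y)) refl k _ _) (eval-*ˡ k f L)) (sym (distribˡ _ _ _))

    eval-*ʳ : ∀ k (f : X → Carrier) L → eval (λ x → f x * k) L ≈ eval f L * k
    eval-*ʳ k f L = trans (eval-cong (λ x → *-comm _ _) L) (trans (eval-*ˡ k f L) (*-comm _ _))

    eval-⟪⟫ : ∀ (f : X → Carrier) x → eval f ⟪ x ⟫ ≈ f x
    eval-⟪⟫ f x = trans (+-identityʳ _) (trans (*-congʳ (coef-1ℚ (+ 0))) (*-identityˡ _))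

    eval-sumBelow : ∀ N (g : X → ℕ → Carrier) L → eval (λ x → sumBelow N (g x)) L ≈ sumBelow N (λ m → eval (λ x → g x m) L)
    eval-sumBelow zero          g L = eval-zero L
    eval-sumBelow (suc zero)    g L = eval-zero L
    eval-sumBelow (suc (suc N)) g L = trans (eval-distrib-+ _ _ L) (+-congˡ (eval-sumBelow (suc N) g L))

  eval-scale : ∀ {X} (f : X → Carrier) r j L → eval f (scale r j L) ≈ coef r j * eval f L
  eval-scale f r j []                  = sym (zeroʳ _)
  eval-scale f r j ((s , i , x) ∷ L) =
    trans (+-cong (trans (*-congʳ (coef-homo-* r j s i)) (*-assoc _ _ _)) (eval-scale f r j L)) (sym (distribˡ _ _ _))

  eval-ext : ∀ {X Y} (f : Y → Carrier) (g : X → Lin Y) L → eval f (ext g L) ≈ eval (λ x → eval f (g x)) L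
  eval-ext f g []                  = refl
  eval-ext f g ((r , j , x) ∷ L) =
    trans (eval-++ f (scale r j (g x)) (ext g L)) (+-cong (eval-scale f r j (g x)) (eval-ext f g L))

  eval-ext2 : ∀ {X Y Z} (f : Z → Carrier) (g : X → Y → Lin Z) U V →
              eval f (ext2 g U V) ≈ eval (λ x → eval (λ y → eval f (g x y)) V) U
  eval-ext2 f g U V = trans (eval-ext f _ U) (eval-cong (λ x → eval-ext f (g x) V) U)

  eval-· : ∀ {A} (f : List A → Carrier) U V → eval f (U · V) ≈ eval (λ u → eval (λ v → f (u ++ v)) V) U
  eval-· f U V = trans (eval-ext2 f (λ u v → ⟪ u ++ v ⟫) U V) (eval-cong (λ u → eval-cong (λ v → eval-⟪⟫ f (u ++ v)) V) U)

  eval-prefix : ∀ {A} (f : List A → Carrier) k L → eval f (prefix k L) ≈ eval (λ w → f (k ∷ w)) L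
  eval-prefix f k []                  = refl
  eval-prefix f k ((r , j , w) ∷ L) = +-congˡ (eval-prefix f k L)

  eval-letters : ∀ {A} (f : List A → Carrier) L → eval f (ext (λ m → ⟪ m ∷ [] ⟫) L) ≈ eval (λ m → f (m ∷ [])) L
  eval-letters f L = trans (eval-ext f (λ m → ⟪ m ∷ [] ⟫) L) (eval-cong (λ m → eval-⟪⟫ f (m ∷ [])) L)

  eval-comm : ∀ {X Y : Set} (g : X → Y → Carrier) U V →
              eval (λ x → eval (g x) V) U ≈ eval (λ y → eval (λ x → g x y) U) V
  eval-comm g []                  V = sym (eval-zero V)
  eval-comm g ((r , j , x) ∷ U) V = begin
    coef r j * eval (g x) V + eval (λ x → eval (g x) V) U
      ≈⟨ +-cong (sym (eval-*ˡ (coef r j) (g x) V)) (eval-comm g U V) ⟩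
    eval (λ y → coef r j * g x y) V + eval (λ y → eval (λ x → g x y) U) V ≈⟨ eval-distrib-+ _ _ V ⟨
    eval (λ y → eval (λ x → g x y) ((r , j , x) ∷ U)) V             ∎

module RootsOfUnity {c ℓ : Level} (F : Field c ℓ) (n : ℕ) (ζ : Field.Carrier F) (prim : Values.PrimitiveRoot F n ζ) where
  open FieldArithmetic F
  open AtRoot n ζ

  ζ^m≉1 : ∀ m → 1 ≤ m → m ℕ.< n → ¬ (pow ζ m ≈ 1#)
  ζ^m≉1 = proj₂ prim

  ħ≉0 : 2 ≤ n → ¬ (ħ ≈ 0#)
  ħ≉0 2≤n ħ≈0 = ζ^m≉1 1 (s≤s z≤n) 2≤n (trans (*-identityʳ ζ) (sym (x-y≈0⇒x≈y ħ≈0)))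

  [m]≉0 : 2 ≤ n → ∀ m → 1 ≤ m → m ℕ.< n → ¬ ([ m ] ≈ 0#)
  [m]≉0 2≤n m 1≤m m<n = *-≉0 (λ 1-ζ^m≈0 → ζ^m≉1 m 1≤m m<n (sym (x-y≈0⇒x≈y 1-ζ^m≈0))) (⁻¹-≉0 (ħ≉0 2≤n))

module AtPrimitiveRoot {c ℓ : Level} (F : Field c ℓ) (char0 : Values.CharZero F) (n : ℕ) (2≤n : 2 ≤ n)
                       (ζ : Field.Carrier F) (prim : Values.PrimitiveRoot F n ζ) where
  open RootsOfUnity F n ζ prim using (ħ≉0; [m]≉0)
  open LinearEvaluation F char0 n ζ (ħ≉0 2≤n) public

  q y x : ℕ → Carrier
  q m = pow ζ m
  y m = [ m ] ⁻¹
  x m = Fk one-bar m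

  y*[m]≈1 : ∀ m → 1 ≤ m → m ℕ.< n → y m * [ m ] ≈ 1#
  y*[m]≈1 m 1≤m m<n = ⁻¹-inverseˡ [ m ] ([m]≉0 2≤n m 1≤m m<n)

  [m]*ħ≈1-q : ∀ m → [ m ] * ħ ≈ 1# - q m
  [m]*ħ≈1-q m = trans (*-assoc _ _ _) (trans (*-congˡ (⁻¹-inverseˡ ħ (ħ≉0 2≤n))) (*-identityʳ _))

  x+ħ≈y : ∀ m → 1 ≤ m → m ℕ.< n → x m + ħ ≈ y m
  x+ħ≈y m 1≤m m<n = begin
    q m * y m + ħ                   ≈⟨ +-congˡ (trans (*-congˡ (y*[m]≈1 m 1≤m m<n)) (*-identityʳ ħ)) ⟨
    q m * y m + ħ * (y m * [ m ])
      ≈⟨ solve 4 (λ q y h b → q :* y :+ h :* (y :* b) := y :* (q :+ b :* h)) refl (q m) (y m) ħ [ m ] ⟩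
    y m * (q m + [ m ] * ħ)         ≈⟨ *-congˡ (+-congˡ ([m]*ħ≈1-q m)) ⟩
    y m * (q m + (1# - q m))        ≈⟨ *-congˡ (solve 2 (λ q o → q :+ (o :- q) := o) refl (q m) 1#) ⟩
    y m * 1#                        ≈⟨ *-identityʳ (y m) ⟩
    y m                             ∎

  Fk-nat : ∀ k m → 1 ≤ m → m ℕ.< n → Fk (nat k) m ≈ q m ^ k * y m ^ suc k
  Fk-nat k m 1≤m m<n = *-cong ζ^[km] [m]^[k+1]⁻¹
    where
    ζ^[km] : pow ζ (k ℕ.* m) ≈ q m ^ k
    ζ^[km] = begin
      pow ζ (k ℕ.* m)   ≡⟨ ≡.trans (pow≡^ ζ (k ℕ.* m)) (≡.cong (ζ ^_) (ℕP.*-comm k m)) ⟩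
      ζ ^ (m ℕ.* k)     ≈⟨ ^-assocʳ ζ m k ⟨
      (ζ ^ m) ^ k       ≡⟨ ≡.cong (_^ k) (pow≡^ ζ m) ⟨
      q m ^ k           ∎
    [m]^[k+1]⁻¹ : pow [ m ] (suc k) ⁻¹ ≈ y m ^ suc k
    [m]^[k+1]⁻¹ = trans (⁻¹-cong (reflexive (pow≡^ [ m ] (suc k))))
                        (sym (⁻¹-unique (^-inverse ([m]≉0 2≤n m 1≤m m<n) (suc k))))

  Fk-nat≈y*x^k : ∀ k m → 1 ≤ m → m ℕ.< n → Fk (nat k) m ≈ y m * x m ^ k
  Fk-nat≈y*x^k k m 1≤m m<n = begin
    Fk (nat k) m               ≈⟨ Fk-nat k m 1≤m m<n ⟩
    q m ^ k * (y m * y m ^ k)  ≈⟨ solve 3 (λ y a b → a :* (y :* b) := y :* (a :* b)) refl (y m) (q m ^ k) (y m ^ k) ⟩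
    y m * (q m ^ k * y m ^ k)  ≈⟨ *-congˡ (^-distrib-* (q m) (y m) k) ⟨
    y m * x m ^ k              ∎

  y-ħ≈x : ∀ m → 1 ≤ m → m ℕ.< n → y m - ħ ≈ x m
  y-ħ≈x m 1≤m m<n = trans (+-congʳ (sym (x+ħ≈y m 1≤m m<n))) (solve 2 (λ u h → (u :+ h) :- h := u) refl (x m) ħ)

  -- Stuffle

  Fk-∘q : ∀ k l m → 1 ≤ m → m ℕ.< n → eval (λ j → Fk j m) (k ∘q l) ≈ Fk k m * Fk l m
  Fk-∘q one-bar one-bar m 1≤m m<n = begin
    coef ℚ.1ℚ (+ 0) * Fk (nat 1) m + (coef (ℚ.- ℚ.1ℚ) (+ 1) * x m + 0#)
      ≈⟨ +-cong (trans (*-congʳ (coef-1ℚ (+ 0))) (trans (*-identityˡ _) (Fk-nat≈y*x^k 1 m 1≤m m<n)))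
                (trans (+-identityʳ _) (*-congʳ (coef-‿1ℚ (+ 1)))) ⟩
    y m * (x m * 1#) + - (ħ * 1#) * x m
      ≈⟨ +-cong (*-congˡ (*-identityʳ (x m))) (*-congʳ (-‿cong (*-identityʳ ħ))) ⟩
    y m * x m + - ħ * x m     ≈⟨ solve 3 (λ y x h → y :* x :+ (:- h) :* x := x :* (y :- h)) refl (y m) (x m) ħ ⟩
    x m * (y m - ħ)           ≈⟨ *-congˡ (y-ħ≈x m 1≤m m<n) ⟩
    x m * x m                 ∎
  Fk-∘q one-bar (nat l) m 1≤m m<n = begin
    eval (λ j → Fk j m) ⟪ nat (suc l) ⟫  ≈⟨ eval-⟪⟫ (λ j → Fk j m) (nat (suc l)) ⟩
    Fk (nat (suc l)) m                  ≈⟨ Fk-nat≈y*x^k (suc l) m 1≤m m<n ⟩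
    y m * (x m * x m ^ l)               ≈⟨ solve 3 (λ y x z → y :* (x :* z) := x :* (y :* z)) refl (y m) (x m) (x m ^ l) ⟩
    x m * (y m * x m ^ l)               ≈⟨ *-congˡ (Fk-nat≈y*x^k l m 1≤m m<n) ⟨
    x m * Fk (nat l) m                  ∎
  Fk-∘q (nat k) one-bar m 1≤m m<n =
    trans (Fk-∘q one-bar (nat k) m 1≤m m<n) (*-comm (x m) (Fk (nat k) m))
  Fk-∘q (nat k) (nat l) m 1≤m m<n = begin
    coef ℚ.1ℚ (+ 0) * Fk (nat (suc (k ℕ.+ l))) m + (coef ℚ.1ℚ (+ 1) * Fk (nat (k ℕ.+ l)) m + 0#)
      ≈⟨ +-cong (trans (*-congʳ (coef-1ℚ (+ 0))) (trans (*-identityˡ _) (Fk-nat≈y*x^k (suc (k ℕ.+ l)) m 1≤m m<n)))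
                (trans (+-identityʳ _) (*-cong (trans (coef-1ℚ (+ 1)) (*-identityʳ ħ)) (Fk-nat≈y*x^k (k ℕ.+ l) m 1≤m m<n))) ⟩
    y m * (x m * x m ^ (k ℕ.+ l)) + ħ * (y m * x m ^ (k ℕ.+ l))
      ≈⟨ solve 4 (λ y x z h → y :* (x :* z) :+ h :* (y :* z) := (y :* z) :* (x :+ h)) refl (y m) (x m) (x m ^ (k ℕ.+ l)) ħ ⟩
    (y m * x m ^ (k ℕ.+ l)) * (x m + ħ)   ≈⟨ *-cong (*-congˡ (^-homo-* (x m) k l)) (x+ħ≈y m 1≤m m<n) ⟩
    (y m * (x m ^ k * x m ^ l)) * y m
      ≈⟨ solve 3 (λ y a b → (y :* (a :* b)) :* y := (y :* a) :* (y :* b)) refl (y m) (x m ^ k) (x m ^ l) ⟩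
    (y m * x m ^ k) * (y m * x m ^ l)     ≈⟨ *-cong (Fk-nat≈y*x^k k m 1≤m m<n) (Fk-nat≈y*x^k l m 1≤m m<n) ⟨
    Fk (nat k) m * Fk (nat l) m           ∎

  eval-zsum-prefix : ∀ M k L → eval (zsum (suc (suc M))) (prefix k L)
                               ≈ Fk k (suc M) * eval (zsum (suc M)) L + eval (zsum (suc M)) (prefix k L)
  eval-zsum-prefix M k L = begin
    eval (zsum (suc (suc M))) (prefix k L)                                  ≈⟨ eval-prefix (zsum (suc (suc M))) k L ⟩
    eval (λ v → Fk k (suc M) * zsum (suc M) v + zsum (suc M) (k ∷ v)) L      ≈⟨ eval-distrib-+ _ _ L ⟩
    eval (λ v → Fk k (suc M) * zsum (suc M) v) L + eval (λ v → zsum (suc M) (k ∷ v)) L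
      ≈⟨ +-cong (eval-*ˡ _ _ L) (sym (eval-prefix (zsum (suc M)) k L)) ⟩
    Fk k (suc M) * eval (zsum (suc M)) L + eval (zsum (suc M)) (prefix k L) ∎

  eval-zsum≤1-prefix : ∀ N → N ≤ 1 → ∀ k L → eval (zsum N) (prefix k L) ≈ 0#
  eval-zsum≤1-prefix zero       _ k L = trans (eval-prefix (zsum 0) k L) (eval-zero L)
  eval-zsum≤1-prefix (suc zero) _ k L = trans (eval-prefix (zsum 1) k L) (eval-zero L)
  eval-zsum≤1-prefix (suc (suc N)) (s≤s ()) k L

  module _ (k l : ℕ̂) (u u′ : Index) where
    private
      X = stuffleW u (l ∷ u′)
      Y = stuffleW (k ∷ u) u′
      R = stuffleW u u′
      Z = ext (λ m → prefix m R) (k ∘q l)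

    eval-stuffleW-cons : ∀ (f : Index → Carrier) →
      eval f (stuffleW (k ∷ u) (l ∷ u′)) ≈ eval f (prefix k X) + (eval f (prefix l Y) + eval f Z)
    eval-stuffleW-cons f = trans (eval-++ f (prefix k X) _) (+-congˡ (eval-++ f (prefix l Y) Z))

    eval-zsum≤1-stuffleW-cons : ∀ N → N ≤ 1 → eval (zsum N) (stuffleW (k ∷ u) (l ∷ u′)) ≈ 0#
    eval-zsum≤1-stuffleW-cons N N≤1 = begin
      eval (zsum N) (stuffleW (k ∷ u) (l ∷ u′))   ≈⟨ eval-stuffleW-cons (zsum N) ⟩
      eval (zsum N) (prefix k X) + (eval (zsum N) (prefix l Y) + eval (zsum N) Z)
        ≈⟨ +-cong (vanish k X) (+-cong (vanish l Y) (trans (eval-ext (zsum N) _ (k ∘q l))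
                  (trans (eval-cong (λ m → vanish m R) (k ∘q l)) (eval-zero (k ∘q l))))) ⟩
      0# + (0# + 0#)                              ≈⟨ trans (+-identityˡ _) (+-identityˡ 0#) ⟩
      0#                                          ∎
      where vanish = eval-zsum≤1-prefix N N≤1

    -- Split off the terms whose largest summation index is M + 1.
    eval-zsum-stuffleW-cons : ∀ M → let M′ = suc M; z = eval (zsum M′) in
      eval (zsum (suc M′)) (stuffleW (k ∷ u) (l ∷ u′))
      ≈ (Fk k M′ * z X + (Fk l M′ * z Y + eval (λ j → Fk j M′) (k ∘q l) * z R)) + z (stuffleW (k ∷ u) (l ∷ u′))
    eval-zsum-stuffleW-cons M = begin
      eval (zsum N) (stuffleW (k ∷ u) (l ∷ u′))   ≈⟨ eval-stuffleW-cons (zsum N) ⟩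
      eval (zsum N) (prefix k X) + (eval (zsum N) (prefix l Y) + eval (zsum N) Z)
        ≈⟨ +-cong (eval-zsum-prefix M k X) (+-cong (eval-zsum-prefix M l Y) Z-step) ⟩
      (Fk k M′ * z X + z (prefix k X)) + ((Fk l M′ * z Y + z (prefix l Y)) + (W * z R + z Z))
        ≈⟨ solve 9 (λ a b c d e f g h i → (a :* b :+ c) :+ ((d :* e :+ f) :+ (g :* h :+ i))
                                          := (a :* b :+ (d :* e :+ g :* h)) :+ (c :+ (f :+ i))) refl _ _ _ _ _ _ _ _ _ ⟩
      (Fk k M′ * z X + (Fk l M′ * z Y + W * z R)) + (z (prefix k X) + (z (prefix l Y) + z Z))
        ≈⟨ +-congˡ (eval-stuffleW-cons (zsum M′)) ⟨
      (Fk k M′ * z X + (Fk l M′ * z Y + W * z R)) + z (stuffleW (k ∷ u) (l ∷ u′)) ∎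
      where
      N = suc (suc M)
      M′ = suc M
      z = eval (zsum M′)
      W = eval (λ j → Fk j M′) (k ∘q l)
      Z-step : eval (zsum N) Z ≈ W * z R + z Z
      Z-step = begin
        eval (zsum N) Z                                       ≈⟨ eval-ext (zsum N) _ (k ∘q l) ⟩
        eval (λ m → eval (zsum N) (prefix m R)) (k ∘q l)      ≈⟨ eval-cong (λ m → eval-zsum-prefix M m R) (k ∘q l) ⟩
        eval (λ m → Fk m M′ * z R + z (prefix m R)) (k ∘q l)  ≈⟨ eval-distrib-+ _ _ (k ∘q l) ⟩
        eval (λ m → Fk m M′ * z R) (k ∘q l) + eval (λ m → z (prefix m R)) (k ∘q l)
          ≈⟨ +-cong (eval-*ʳ (z R) (λ m → Fk m M′) (k ∘q l)) (sym (eval-ext (zsum M′) _ (k ∘q l))) ⟩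
        W * z R + z Z                                         ∎

  zsum-stuffleW : ∀ N → N ≤ n → ∀ w w′ → eval (zsum N) (stuffleW w w′) ≈ zsum N w * zsum N w′
  zsum-stuffleW N N≤n []      w′       = trans (eval-⟪⟫ (zsum N) w′) (sym (*-identityˡ _))
  zsum-stuffleW N N≤n (k ∷ w) []       = trans (eval-⟪⟫ (zsum N) (k ∷ w)) (sym (*-identityʳ _))
  zsum-stuffleW zero       N≤n (k ∷ u) (l ∷ u′) = trans (eval-zsum≤1-stuffleW-cons k l u u′ 0 z≤n) (sym (zeroˡ _))
  zsum-stuffleW (suc zero) N≤n (k ∷ u) (l ∷ u′) =
    trans (eval-zsum≤1-stuffleW-cons k l u u′ 1 ℕP.≤-refl) (sym (zeroˡ _))
  zsum-stuffleW (suc N@(suc M)) N<n (k ∷ u) (l ∷ u′) = begin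
    eval (zsum (suc N)) (stuffleW (k ∷ u) (l ∷ u′))
      ≈⟨ eval-zsum-stuffleW-cons k l u u′ M ⟩
    (Fk k N * z (stuffleW u (l ∷ u′))
       + (Fk l N * z (stuffleW (k ∷ u) u′) + eval (λ j → Fk j N) (k ∘q l) * z (stuffleW u u′)))
      + z (stuffleW (k ∷ u) (l ∷ u′))
      ≈⟨ +-cong (+-cong (*-congˡ (zsum-stuffleW N N≤n u (l ∷ u′)))
                        (+-cong (*-congˡ (zsum-stuffleW N N≤n (k ∷ u) u′))
                                (*-cong (Fk-∘q k l N (s≤s z≤n) N<n) (zsum-stuffleW N N≤n u u′))))
                (zsum-stuffleW N N≤n (k ∷ u) (l ∷ u′)) ⟩
    (Fk k N * (Zu * Zlu′) + (Fk l N * (Zku * Zu′) + (Fk k N * Fk l N) * (Zu * Zu′))) + Zku * Zlu′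
      ≈⟨ solve 6 (λ p q a b c d → (p :* (a :* b) :+ (q :* (c :* d) :+ (p :* q) :* (a :* d))) :+ c :* b
                                 := (p :* a :+ c) :* (q :* d :+ b)) refl (Fk k N) (Fk l N) Zu Zlu′ Zku Zu′ ⟩
    (Fk k N * Zu + Zku) * (Fk l N * Zu′ + Zlu′) ∎
    where
    z = eval (zsum N)
    N≤n = ℕP.<⇒≤ N<n
    Zu = zsum N u
    Zu′ = zsum N u′
    Zku = zsum N (k ∷ u)
    Zlu′ = zsum N (l ∷ u′)

  zn-*q : (w w′ : Ĥ¹) → zn (w *q w′) ≈ zn w * zn w′
  zn-*q w w′ = begin
    zn (w *q w′)                                            ≡⟨ zn≡eval (w *q w′) ⟩
    eval zIndex (ext2 stuffleW w w′)                        ≈⟨ eval-ext2 zIndex stuffleW w w′ ⟩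
    eval (λ 𝐤 → eval (λ 𝐥 → eval zIndex (stuffleW 𝐤 𝐥)) w′) w
      ≈⟨ eval-cong (λ 𝐤 → eval-cong (λ 𝐥 → zsum-stuffleW n ℕP.≤-refl 𝐤 𝐥) w′) w ⟩
    eval (λ 𝐤 → eval (λ 𝐥 → zIndex 𝐤 * zIndex 𝐥) w′) w    ≈⟨ eval-cong (λ 𝐤 → eval-*ˡ (zIndex 𝐤) zIndex w′) w ⟩
    eval (λ 𝐤 → zIndex 𝐤 * eval zIndex w′) w               ≈⟨ eval-*ʳ (eval zIndex w′) zIndex w ⟩
    eval zIndex w * eval zIndex w′                          ≡⟨ ≡.cong₂ _*_ (zn≡eval w) (zn≡eval w′) ⟨
    zn w * zn w′                                            ∎

  -- Shuffle

  q-homo-+ : ∀ m p → q (m ℕ.+ p) ≈ q m * q p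
  q-homo-+ m p = begin
    pow ζ (m ℕ.+ p)       ≡⟨ pow≡^ ζ (m ℕ.+ p) ⟩
    ζ ^ (m ℕ.+ p)         ≈⟨ ^-homo-* ζ m p ⟩
    ζ ^ m * ζ ^ p         ≡⟨ ≡.cong₂ _*_ (pow≡^ ζ m) (pow≡^ ζ p) ⟨
    pow ζ m * pow ζ p     ∎

  y-x≈ħ : ∀ m → 1 ≤ m → m ℕ.< n → y m - x m ≈ ħ
  y-x≈ħ m 1≤m m<n = trans (+-congʳ (sym (x+ħ≈y m 1≤m m<n))) (solve 2 (λ u h → (u :+ h) :- u := h) refl (x m) ħ)

  [m+p]≈[p]+q[m] : ∀ m p → [ m ℕ.+ p ] ≈ [ p ] + q p * [ m ]
  [m+p]≈[p]+q[m] m p = *-cancelʳ (ħ≉0 2≤n) (begin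
    [ m ℕ.+ p ] * ħ                  ≈⟨ [m]*ħ≈1-q (m ℕ.+ p) ⟩
    1# - q (m ℕ.+ p)                 ≈⟨ +-congˡ (-‿cong (q-homo-+ m p)) ⟩
    1# - q m * q p                   ≈⟨ solve 3 (λ o a c → o :- a :* c := (o :- c) :+ (c :- c :* a)) refl 1# (q m) (q p) ⟩
    (1# - q p) + (q p - q p * q m)   ≈⟨ +-congˡ (x*[1-y]≈x-x*y (q p) (q m)) ⟨
    (1# - q p) + q p * (1# - q m)    ≈⟨ +-cong ([m]*ħ≈1-q p) (*-congˡ ([m]*ħ≈1-q m)) ⟨
    [ p ] * ħ + q p * ([ m ] * ħ)
      ≈⟨ solve 4 (λ a b c h → a :* h :+ c :* (b :* h) := (a :+ c :* b) :* h) refl [ p ] [ m ] (q p) ħ ⟩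
    ([ p ] + q p * [ m ]) * ħ        ∎)

  y*y≈y[m+p]*[y+x] : ∀ m p → 1 ≤ m → 1 ≤ p → m ℕ.+ p ℕ.< n → y m * y p ≈ y (m ℕ.+ p) * (y m + x p)
  y*y≈y[m+p]*[y+x] m p 1≤m 1≤p m+p<n = begin
    y m * y p                                                    ≈⟨ *-identityˡ _ ⟨
    1# * (y m * y p)                                             ≈⟨ *-congʳ (y*[m]≈1 s 1≤s m+p<n) ⟨
    (y s * [ s ]) * (y m * y p)                                  ≈⟨ *-congʳ (*-congˡ ([m+p]≈[p]+q[m] m p)) ⟩
    (y s * ([ p ] + q p * [ m ])) * (y m * y p)
      ≈⟨ solve 6 (λ ys bp qp bm ym yp → (ys :* (bp :+ qp :* bm)) :* (ym :* yp)
                                      := ys :* (ym :* (yp :* bp) :+ qp :* yp :* (ym :* bm)))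
                 refl (y s) [ p ] (q p) [ m ] (y m) (y p) ⟩
    y s * (y m * (y p * [ p ]) + x p * (y m * [ m ]))
      ≈⟨ *-congˡ (+-cong (*-congˡ (y*[m]≈1 p 1≤p p<n)) (*-congˡ (y*[m]≈1 m 1≤m m<n))) ⟩
    y s * (y m * 1# + x p * 1#)                                  ≈⟨ *-congˡ (+-cong (*-identityʳ _) (*-identityʳ _)) ⟩
    y s * (y m + x p)                                            ∎
    where
    s = m ℕ.+ p
    1≤s = ℕP.≤-trans 1≤m (ℕP.m≤m+n m p)
    m<n = ℕP.<-≤-trans (ℕP.m<m+n m 1≤p) (ℕP.<⇒≤ m+p<n)
    p<n = ℕP.<-≤-trans (ℕP.m<n+m p 1≤m) (ℕP.<⇒≤ m+p<n)

  -- The q-analogue of the partial fractions 1/(m p) = 1/(m+p) (1/m + 1/p); it drives the aa-rule of ⧢q.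
  x*x≈x[m+p]*[x+x+ħ] : ∀ m p → 1 ≤ m → 1 ≤ p → m ℕ.+ p ℕ.< n → x m * x p ≈ x (m ℕ.+ p) * ((x m + x p) + ħ)
  x*x≈x[m+p]*[x+x+ħ] m p 1≤m 1≤p m+p<n = begin
    (q m * y m) * (q p * y p)                ≈⟨ *-interchange _ _ _ _ ⟩
    (q m * q p) * (y m * y p)                ≈⟨ *-cong (sym (q-homo-+ m p)) (y*y≈y[m+p]*[y+x] m p 1≤m 1≤p m+p<n) ⟩
    q s * (y s * (y m + x p))                ≈⟨ *-congˡ (*-congˡ (+-congʳ (x+ħ≈y m 1≤m m<n))) ⟨
    q s * (y s * ((x m + ħ) + x p))          ≈⟨ solve 5 (λ a b c h d → a :* (b :* ((c :+ h) :+ d)) := (a :* b) :* ((c :+ d) :+ h))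
                                                       refl (q s) (y s) (x m) ħ (x p) ⟩
    x s * ((x m + x p) + ħ)                  ∎
    where
    s = m ℕ.+ p
    m<n = ℕP.<-≤-trans (ℕP.m<m+n m 1≤p) (ℕP.<⇒≤ m+p<n)

  module Reflection (l : ℕ) (1≤l : 1 ≤ l) (l<n : l ℕ.< n) where
    l′ : ℕ
    l′ = n ℕ.∸ l

    1≤l′ : 1 ≤ l′
    1≤l′ = ℕP.m<n⇒0<n∸m l<n

    l′<n : l′ ℕ.< n
    l′<n = ℕP.∸-monoʳ-< {m = n} {n = l} {o = 0} 1≤l (ℕP.<⇒≤ l<n)

    q′*q≈1 : q l′ * q l ≈ 1#
    q′*q≈1 = trans (sym (q-homo-+ l′ l)) (trans (reflexive (≡.cong q (ℕP.m∸n+n≡m (ℕP.<⇒≤ l<n)))) (proj₁ prim))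

    [l′]≈-q′[l] : [ l′ ] ≈ - (q l′ * [ l ])
    [l′]≈-q′[l] = *-cancelʳ (ħ≉0 2≤n) (begin
      [ l′ ] * ħ                     ≈⟨ [m]*ħ≈1-q l′ ⟩
      1# - q l′                      ≈⟨ +-congʳ q′*q≈1 ⟨
      q l′ * q l - q l′              ≈⟨ solve 2 (λ a c → a :* c :- a := :- (a :- a :* c)) refl (q l′) (q l) ⟩
      - (q l′ - q l′ * q l)          ≈⟨ -‿cong (x*[1-y]≈x-x*y (q l′) (q l)) ⟨
      - (q l′ * (1# - q l))          ≈⟨ -‿cong (*-congˡ ([m]*ħ≈1-q l)) ⟨
      - (q l′ * ([ l ] * ħ))         ≈⟨ solve 3 (λ a b h → :- (a :* (b :* h)) := (:- (a :* b)) :* h) refl (q l′) [ l ] ħ ⟩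
      - (q l′ * [ l ]) * ħ           ∎)

    y′≈-x : y l′ ≈ - x l
    y′≈-x = trans (⁻¹-cong [l′]≈-q′[l]) (sym (⁻¹-unique (begin
      - (q l′ * [ l ]) * - (q l * y l)
        ≈⟨ solve 4 (λ a b c d → (:- (a :* b)) :* (:- (c :* d)) := (a :* c) :* (d :* b)) refl (q l′) [ l ] (q l) (y l) ⟩
      (q l′ * q l) * (y l * [ l ])       ≈⟨ *-cong q′*q≈1 (y*[m]≈1 l 1≤l l<n) ⟩
      1# * 1#                            ≈⟨ *-identityˡ 1# ⟩
      1#                                 ∎)))

    x′≈-y : x l′ ≈ - y l
    x′≈-y = begin
      q l′ * y l′               ≈⟨ *-congˡ y′≈-x ⟩
      q l′ * - (q l * y l)      ≈⟨ solve 3 (λ a b c → a :* (:- (b :* c)) := :- ((a :* b) :* c)) refl (q l′) (q l) (y l) ⟩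
      - ((q l′ * q l) * y l)    ≈⟨ -‿cong (trans (*-congʳ q′*q≈1) (*-identityˡ (y l))) ⟩
      - y l                     ∎

    σ : ℕ → Carrier
    σ k = (- 1#) ^ k

    ψterm : ℕ → ℕ → Carrier
    ψterm k t = (k C t) ×ᴺ (x l ^ t * ħ ^ (k ℕ.∸ t))

    eval-ψterm : ∀ k t → coef (signℚ k ℚ.* ℕ→ℚ (k C t)) (+ (k ℕ.∸ t)) * Fk (nat (suc t)) l ≈ (σ k * (y l * x l)) * ψterm k t
    eval-ψterm k t = begin
      (ℚ→F (signℚ k ℚ.* ℕ→ℚ (k C t)) * pow ħ (k ℕ.∸ t)) * Fk (nat (suc t)) l
        ≈⟨ *-cong (*-cong (trans (ℚ→F-homo-* (signℚ k) (ℕ→ℚ (k C t))) (*-cong (ℚ→F-signℚ k) (ℚ→F-ℕ→ℚ (k C t))))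
                          (reflexive (pow≡^ ħ (k ℕ.∸ t))))
                  (Fk-nat≈y*x^k (suc t) l 1≤l l<n) ⟩
      ((σ k * ℕ→F (k C t)) * ħ ^ (k ℕ.∸ t)) * (y l * (x l * x l ^ t))
        ≈⟨ solve 6 (λ s c h y x z → ((s :* c) :* h) :* (y :* (x :* z)) := (s :* (y :* x)) :* (c :* (z :* h)))
                   refl (σ k) (ℕ→F (k C t)) (ħ ^ (k ℕ.∸ t)) (y l) (x l) (x l ^ t) ⟩
      (σ k * (y l * x l)) * (ℕ→F (k C t) * (x l ^ t * ħ ^ (k ℕ.∸ t)))  ≈⟨ *-congˡ (ℕ→F-*≈× (k C t) _) ⟩
      (σ k * (y l * x l)) * ψterm k t                                   ∎

    eval-ψsum : ∀ k t → eval (λ j → Fk j l) (ψsum k t) ≈ (σ k * (y l * x l)) * ∑[ i ≤ t ] ψterm k (toℕ i)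
    eval-ψsum k zero    = trans (+-cong (eval-ψterm k 0) (sym (zeroʳ _))) (sym (distribˡ _ _ _))
    eval-ψsum k (suc t) = begin
      eval (λ j → Fk j l) (ψsum k (suc t))                       ≈⟨ +-cong (eval-ψterm k (suc t)) (eval-ψsum k t) ⟩
      S * ψterm k (suc t) + S * ∑[ i ≤ t ] ψterm k (toℕ i)       ≈⟨ distribˡ _ _ _ ⟨
      S * (ψterm k (suc t) + ∑[ i ≤ t ] ψterm k (toℕ i))         ≈⟨ *-congˡ (∑≤-suc t (ψterm k)) ⟨
      S * ∑[ i ≤ suc t ] ψterm k (toℕ i)                         ∎
      where S = σ k * (y l * x l)

    -- ψ is what the substitution m ↦ n − m does to the weights F_k.
    Fk-ψletter : ∀ k → eval (λ j → Fk j l) (ψletter k) ≈ Fk k l′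
    Fk-ψletter one-bar = begin
      coef (ℚ.- ℚ.1ℚ) (+ 0) * Fk (nat 0) l + 0#
        ≈⟨ trans (+-identityʳ _) (*-cong (coef-‿1ℚ (+ 0)) (Fk-nat≈y*x^k 0 l 1≤l l<n)) ⟩
      - 1# * (y l * 1#)                           ≈⟨ trans (-1*x≈-x _) (-‿cong (*-identityʳ (y l))) ⟩
      - y l                                       ≈⟨ x′≈-y ⟨
      x l′                                        ∎
    Fk-ψletter (nat zero) = begin
      coef (ℚ.- ℚ.1ℚ) (+ 0) * x l + 0#
        ≈⟨ trans (+-identityʳ _) (trans (*-congʳ (coef-‿1ℚ (+ 0))) (-1*x≈-x (x l))) ⟩
      - x l                                       ≈⟨ y′≈-x ⟨
      y l′                                        ≈⟨ trans (Fk-nat≈y*x^k 0 l′ 1≤l′ l′<n) (*-identityʳ (y l′)) ⟨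
      Fk (nat 0) l′                               ∎
    Fk-ψletter (nat (suc k)) = begin
      eval (λ j → Fk j l) (ψsum k k)              ≈⟨ eval-ψsum k k ⟩
      (σ k * (y l * x l)) * binomialExpansion (x l) ħ k
                                                  ≈⟨ *-congˡ (binomial-theorem k (x l) ħ) ⟨
      (σ k * (y l * x l)) * (x l + ħ) ^ k         ≈⟨ *-congˡ (^-congˡ k (x+ħ≈y l 1≤l l<n)) ⟩
      (σ k * (y l * x l)) * y l ^ k               ≈⟨ solve 4 (λ s y x z → (s :* (y :* x)) :* z := (:- x) :* ((:- s) :* (y :* z)))
                                                             refl (σ k) (y l) (x l) (y l ^ k) ⟩
      - x l * (- σ k * (y l * y l ^ k))
        ≈⟨ *-cong (sym y′≈-x) (trans (*-congʳ (sym (-1*x≈-x (σ k)))) (sym (-‿^ (y l) (suc k)))) ⟩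
      y l′ * (- y l) ^ suc k                      ≈⟨ *-congˡ (^-congˡ (suc k) x′≈-y) ⟨
      y l′ * x l′ ^ suc k                         ≈⟨ Fk-nat≈y*x^k (suc k) l′ 1≤l′ l′<n ⟨
      Fk (nat (suc k)) l′                         ∎

  Fk-blockÊ : ∀ j m → 1 ≤ m → m ℕ.< n → eval (λ k → Fk k m) (blockÊ j) ≈ x m ^ j
  Fk-blockÊ zero m 1≤m m<n = begin
    coef ℚ.1ℚ -[1+ 0 ] * Fk (nat 0) m + (coef (ℚ.- ℚ.1ℚ) -[1+ 0 ] * x m + 0#)
      ≈⟨ +-cong (*-cong (coef-1ℚ -[1+ 0 ]) (Fk-nat≈y*x^k 0 m 1≤m m<n)) (trans (+-identityʳ _) (*-congʳ (coef-‿1ℚ -[1+ 0 ]))) ⟩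
    ħ ⁻¹ ^ 1 * (y m * 1#) + - ħ ⁻¹ ^ 1 * x m
      ≈⟨ solve 4 (λ i o y x → i :* (y :* o) :+ (:- i) :* x := i :* (y :* o :- x)) refl (ħ ⁻¹ ^ 1) 1# (y m) (x m) ⟩
    ħ ⁻¹ ^ 1 * (y m * 1# - x m)    ≈⟨ *-cong (*-identityʳ (ħ ⁻¹)) (trans (+-congʳ (*-identityʳ (y m))) (y-x≈ħ m 1≤m m<n)) ⟩
    ħ ⁻¹ * ħ                       ≈⟨ ⁻¹-inverseˡ ħ (ħ≉0 2≤n) ⟩
    1#                             ∎
  Fk-blockÊ (suc zero) m 1≤m m<n = trans (eval-⟪⟫ (λ k → Fk k m) one-bar) (sym (*-identityʳ (x m)))
  Fk-blockÊ (suc (suc j)) m 1≤m m<n = begin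
    eval f (⟪ nat (suc j) ⟫ ++ scale (ℚ.- ℚ.1ℚ) (+ 1) (blockÊ (suc j)))
      ≈⟨ eval-++ f ⟪ nat (suc j) ⟫ (scale (ℚ.- ℚ.1ℚ) (+ 1) (blockÊ (suc j))) ⟩
    eval f ⟪ nat (suc j) ⟫ + eval f (scale (ℚ.- ℚ.1ℚ) (+ 1) (blockÊ (suc j)))
      ≈⟨ +-cong (trans (eval-⟪⟫ f (nat (suc j))) (Fk-nat≈y*x^k (suc j) m 1≤m m<n))
                (trans (eval-scale f (ℚ.- ℚ.1ℚ) (+ 1) (blockÊ (suc j)))
                       (*-cong (coef-‿1ℚ (+ 1)) (Fk-blockÊ (suc j) m 1≤m m<n))) ⟩
    y m * x m ^ suc j + - (ħ * 1#) * x m ^ suc j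
      ≈⟨ solve 4 (λ y h o z → y :* z :+ (:- (h :* o)) :* z := (y :- h :* o) :* z) refl (y m) ħ 1# (x m ^ suc j) ⟩
    (y m - ħ * 1#) * x m ^ suc j       ≈⟨ *-congʳ (trans (+-congˡ (-‿cong (*-identityʳ ħ))) (y-ħ≈x m 1≤m m<n)) ⟩
    x m ^ suc (suc j)                  ∎
    where f = λ k → Fk k m

  -- zword N w sums over N > m₁ > m₂ > ⋯ ≥ 1, one index for each letter b of w, every letter a
  -- contributing a factor x at the index of the next b; zword-at s w has its first index fixed to s.
  zword zword-at : ℕ → List AB → Carrier
  zword N []      = 1#
  zword N (h ∷ u) = sumBelow N (λ s → zword-at s (h ∷ u))
  zword-at s []      = 0#
  zword-at s (a ∷ u) = x s * zword-at s u
  zword-at s (b ∷ u) = zword s u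

  zword-at-block : ∀ s j v → zword-at s (aʷ j ++ b ∷ v) ≈ x s ^ j * zword s v
  zword-at-block s zero    v = sym (*-identityˡ _)
  zword-at-block s (suc j) v = trans (*-congˡ (zword-at-block s j v)) (sym (*-assoc _ _ _))

  zword-block : ∀ N j v → zword N (aʷ j ++ b ∷ v) ≡ sumBelow N (λ s → zword-at s (aʷ j ++ b ∷ v))
  zword-block N zero    v = ≡.refl
  zword-block N (suc j) v = ≡.refl

  zword-at-aʷ : ∀ s j → zword-at s (aʷ j ++ []) ≈ 0#
  zword-at-aʷ s zero    = refl
  zword-at-aʷ s (suc j) = trans (*-congˡ (zword-at-aʷ s j)) (zeroʳ (x s))

  aʷ-suc : ∀ j w → aʷ (suc j) ++ w ≡ aʷ j ++ a ∷ w
  aʷ-suc zero    w = ≡.refl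
  aʷ-suc (suc j) w = ≡.cong (a ∷_) (aʷ-suc j w)

  eval-zsum-prefix-sumBelow : ∀ N k L → eval (zsum N) (prefix k L) ≈ sumBelow N (λ t → Fk k t * eval (zsum t) L)
  eval-zsum-prefix-sumBelow N k L = begin
    eval (zsum N) (prefix k L)                                 ≈⟨ eval-prefix (zsum N) k L ⟩
    eval (λ w → sumBelow N (λ t → Fk k t * zsum t w)) L        ≈⟨ eval-sumBelow N _ L ⟩
    sumBelow N (λ t → eval (λ w → Fk k t * zsum t w) L)        ≈⟨ sumBelow-cong′ N (λ t → eval-*ˡ (Fk k t) (zsum t) L) ⟩
    sumBelow N (λ t → Fk k t * eval (zsum t) L)                ∎

  eval-zsum-block : ∀ w j N → N ≤ n → (∀ t → t ≤ n → eval (zsum t) (expandW 0 w) ≈ zword t w) →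
    eval (zsum N) (ext (λ m → prefix m (expandW 0 w)) (blockÊ j)) ≈ zword N (aʷ j ++ b ∷ w)
  eval-zsum-block w j N N≤n IH = begin
    eval (zsum N) (ext (λ m → prefix m E) (blockÊ j))                         ≈⟨ eval-ext (zsum N) _ (blockÊ j) ⟩
    eval (λ m → eval (zsum N) (prefix m E)) (blockÊ j)
      ≈⟨ eval-cong (λ m → eval-zsum-prefix-sumBelow N m E) (blockÊ j) ⟩
    eval (λ m → sumBelow N (λ t → Fk m t * eval (zsum t) E)) (blockÊ j)       ≈⟨ eval-sumBelow N _ (blockÊ j) ⟩
    sumBelow N (λ t → eval (λ m → Fk m t * eval (zsum t) E) (blockÊ j))
      ≈⟨ sumBelow-cong′ N (λ t → eval-*ʳ _ (λ m → Fk m t) (blockÊ j)) ⟩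
    sumBelow N (λ t → eval (λ m → Fk m t) (blockÊ j) * eval (zsum t) E)
      ≈⟨ sumBelow-cong N (λ t 1≤t t<N → *-cong (Fk-blockÊ j t 1≤t (ℕP.<-≤-trans t<N N≤n))
                                               (IH t (ℕP.<⇒≤ (ℕP.<-≤-trans t<N N≤n)))) ⟩
    sumBelow N (λ t → x t ^ j * zword t w)
      ≈⟨ sumBelow-cong′ N (λ t → zword-at-block t j w) ⟨
    sumBelow N (λ t → zword-at t (aʷ j ++ b ∷ w))                             ≡⟨ zword-block N j w ⟨
    zword N (aʷ j ++ b ∷ w)                                                   ∎
    where E = expandW 0 w

  eval-zsum-expandW : ∀ w j N → N ≤ n → eval (zsum N) (expandW j w) ≈ zword N (aʷ j ++ w)
  eval-zsum-expandW []      zero    N N≤n = eval-⟪⟫ (zsum N) []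
  eval-zsum-expandW []      (suc j) N N≤n =
    sym (trans (sumBelow-cong′ N (λ t → trans (*-congˡ (zword-at-aʷ t j)) (zeroʳ (x t)))) (sumBelow-zero N))
  eval-zsum-expandW (a ∷ w) zero    N N≤n = eval-zsum-expandW w 1 N N≤n
  eval-zsum-expandW (a ∷ w) (suc j) N N≤n =
    trans (eval-zsum-expandW w (suc (suc j)) N N≤n) (reflexive (≡.cong (zword N) (aʷ-suc (suc j) w)))
  eval-zsum-expandW (b ∷ w) zero    N N≤n = eval-zsum-block w 0 N N≤n (eval-zsum-expandW w 0)
  eval-zsum-expandW (b ∷ w) (suc j) N N≤n = eval-zsum-block w (suc j) N N≤n (eval-zsum-expandW w 0)

  blockSum : ℕ̂ → (ℕ → Carrier) → Carrier
  blockSum one-bar g = g 1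
  blockSum (nat k) g = coef ℚ.1ℚ (+ 0) * g (suc k) + coef ℚ.1ℚ (+ 1) * g k

  blockSum-cong : ∀ k {g h : ℕ → Carrier} → (∀ j → g j ≈ h j) → blockSum k g ≈ blockSum k h
  blockSum-cong one-bar g≈h = g≈h 1
  blockSum-cong (nat k) g≈h = +-cong (*-congˡ (g≈h (suc k))) (*-congˡ (g≈h k))

  blockSum-x^ : ∀ k s → 1 ≤ s → s ℕ.< n → ∀ E → blockSum k (λ j → x s ^ j * E) ≈ Fk k s * E
  blockSum-x^ one-bar s 1≤s s<n E = *-congʳ (*-identityʳ (x s))
  blockSum-x^ (nat k) s 1≤s s<n E = begin
    coef ℚ.1ℚ (+ 0) * (x s ^ suc k * E) + coef ℚ.1ℚ (+ 1) * (x s ^ k * E)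
      ≈⟨ +-cong (trans (*-congʳ (coef-1ℚ (+ 0))) (*-identityˡ _)) (*-congʳ (trans (coef-1ℚ (+ 1)) (*-identityʳ ħ))) ⟩
    (x s * x s ^ k) * E + ħ * (x s ^ k * E)
      ≈⟨ solve 4 (λ x z h e → (x :* z) :* e :+ h :* (z :* e) := ((x :+ h) :* z) :* e) refl (x s) (x s ^ k) ħ E ⟩
    ((x s + ħ) * x s ^ k) * E      ≈⟨ *-congʳ (*-congʳ (x+ħ≈y s 1≤s s<n)) ⟩
    (y s * x s ^ k) * E            ≈⟨ *-congʳ (Fk-nat≈y*x^k k s 1≤s s<n) ⟨
    Fk (nat k) s * E               ∎

  eval-wordIn𝔥-cons : ∀ k 𝐤 (f : List AB → Carrier) →
    eval f (wordIn𝔥 (k ∷ 𝐤)) ≈ blockSum k (λ j → eval (λ v → f (aʷ j ++ b ∷ v)) (wordIn𝔥 𝐤))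
  eval-wordIn𝔥-cons one-bar 𝐤 f =
    trans (eval-· f (letterIn𝔥 one-bar) (wordIn𝔥 𝐤)) (eval-⟪⟫ (λ u → eval (λ v → f (u ++ v)) (wordIn𝔥 𝐤)) (a ∷ b ∷ []))
  eval-wordIn𝔥-cons (nat k) 𝐤 f =
    trans (eval-· f (letterIn𝔥 (nat k)) (wordIn𝔥 𝐤))
          (+-cong (*-congˡ (block (suc k))) (trans (+-identityʳ _) (*-congˡ (block k))))
    where
    block : ∀ j → eval (λ v → f ((aʷ j ++ b ∷ []) ++ v)) (wordIn𝔥 𝐤) ≈ eval (λ v → f (aʷ j ++ b ∷ v)) (wordIn𝔥 𝐤)
    block j = eval-cong (λ v → reflexive (≡.cong f (LP.++-assoc (aʷ j) (b ∷ []) v))) (wordIn𝔥 𝐤)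

  eval-wordIn𝔥-cons-cong : ∀ k 𝐤 {f g : List AB → Carrier} → (∀ j v → f (aʷ j ++ b ∷ v) ≈ g (aʷ j ++ b ∷ v)) →
    eval f (wordIn𝔥 (k ∷ 𝐤)) ≈ eval g (wordIn𝔥 (k ∷ 𝐤))
  eval-wordIn𝔥-cons-cong k 𝐤 {f} {g} f≈g = begin
    eval f (wordIn𝔥 (k ∷ 𝐤))                                          ≈⟨ eval-wordIn𝔥-cons k 𝐤 f ⟩
    blockSum k (λ j → eval (λ v → f (aʷ j ++ b ∷ v)) (wordIn𝔥 𝐤))
      ≈⟨ blockSum-cong k (λ j → eval-cong (f≈g j) (wordIn𝔥 𝐤)) ⟩
    blockSum k (λ j → eval (λ v → g (aʷ j ++ b ∷ v)) (wordIn𝔥 𝐤))     ≈⟨ eval-wordIn𝔥-cons k 𝐤 g ⟨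
    eval g (wordIn𝔥 (k ∷ 𝐤))                                          ∎

  zword-at-wordIn𝔥 : ∀ k 𝐤 s → 1 ≤ s → s ℕ.< n →
    eval (zword-at s) (wordIn𝔥 (k ∷ 𝐤)) ≈ Fk k s * eval (zword s) (wordIn𝔥 𝐤)
  zword-at-wordIn𝔥 k 𝐤 s 1≤s s<n = begin
    eval (zword-at s) (wordIn𝔥 (k ∷ 𝐤))                                   ≈⟨ eval-wordIn𝔥-cons k 𝐤 (zword-at s) ⟩
    blockSum k (λ j → eval (λ v → zword-at s (aʷ j ++ b ∷ v)) W)          ≈⟨ blockSum-cong k block ⟩
    blockSum k (λ j → x s ^ j * eval (zword s) W)                         ≈⟨ blockSum-x^ k s 1≤s s<n (eval (zword s) W) ⟩
    Fk k s * eval (zword s) W                                             ∎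
    where
    W = wordIn𝔥 𝐤
    block : ∀ j → eval (λ v → zword-at s (aʷ j ++ b ∷ v)) W ≈ x s ^ j * eval (zword s) W
    block j = trans (eval-cong (zword-at-block s j) W) (eval-*ˡ (x s ^ j) (zword s) W)

  zword-wordIn𝔥 : ∀ 𝐤 N → N ≤ n → eval (zword N) (wordIn𝔥 𝐤) ≈ zsum N 𝐤
  zword-wordIn𝔥 []      N N≤n = eval-⟪⟫ (zword N) []
  zword-wordIn𝔥 (k ∷ 𝐤) N N≤n = begin
    eval (zword N) (wordIn𝔥 (k ∷ 𝐤))
      ≈⟨ eval-wordIn𝔥-cons-cong k 𝐤 (λ j v → reflexive (zword-block N j v)) ⟩
    eval (λ w → sumBelow N (λ s → zword-at s w)) (wordIn𝔥 (k ∷ 𝐤))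
      ≈⟨ eval-sumBelow N (λ w s → zword-at s w) (wordIn𝔥 (k ∷ 𝐤)) ⟩
    sumBelow N (λ s → eval (zword-at s) (wordIn𝔥 (k ∷ 𝐤)))
      ≈⟨ sumBelow-cong N (λ s 1≤s s<N → trans (zword-at-wordIn𝔥 k 𝐤 s 1≤s (ℕP.<-≤-trans s<N N≤n))
                                              (*-congˡ (zword-wordIn𝔥 𝐤 s (ℕP.<⇒≤ (ℕP.<-≤-trans s<N N≤n))))) ⟩
    zsum N (k ∷ 𝐤)                                              ∎

  data InĤ¹ : List AB → Set where
    nil : InĤ¹ []
    b∷_ : ∀ {u} → InĤ¹ u → InĤ¹ (b ∷ u)
    a∷_ : ∀ {h u} → InĤ¹ (h ∷ u) → InĤ¹ (a ∷ h ∷ u)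

  zshuffle : ℕ → List AB → List AB → Carrier
  zshuffle N []      v = zword N v
  zshuffle N (h ∷ u) v = sumBelow N (λ m → zword-at m (h ∷ u) * zword (N ℕ.∸ m) v)

  zpair : ℕ → List AB → List AB → Carrier
  zpair s u v = sumBelow s (λ m → zword-at m u * zword-at (s ℕ.∸ m) v)

  eval-shuffleW-[] : ∀ u (f : List AB → Carrier) → eval f (shuffleW u []) ≈ f u
  eval-shuffleW-[] []      f = eval-⟪⟫ f []
  eval-shuffleW-[] (b ∷ u) f = trans (eval-prefix f b (shuffleW u [])) (eval-shuffleW-[] u (λ w → f (b ∷ w)))
  eval-shuffleW-[] (a ∷ u) f = eval-⟪⟫ f (a ∷ u)

  zword-prefix : ∀ N h L → eval (zword N) (prefix h L) ≈ sumBelow N (λ s → eval (zword-at s) (prefix h L))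
  zword-prefix N h L = begin
    eval (zword N) (prefix h L)                                ≈⟨ eval-prefix (zword N) h L ⟩
    eval (λ w → sumBelow N (λ s → zword-at s (h ∷ w))) L       ≈⟨ eval-sumBelow N (λ w s → zword-at s (h ∷ w)) L ⟩
    sumBelow N (λ s → eval (λ w → zword-at s (h ∷ w)) L)       ≈⟨ sumBelow-cong′ N (λ s → eval-prefix (zword-at s) h L) ⟨
    sumBelow N (λ s → eval (zword-at s) (prefix h L))          ∎

  zword-shuffleW-cons : ∀ N h u d v →
    eval (zword N) (shuffleW (h ∷ u) (d ∷ v)) ≈ sumBelow N (λ s → eval (zword-at s) (shuffleW (h ∷ u) (d ∷ v)))
  zword-shuffleW-cons N b u d v = zword-prefix N b (shuffleW u (d ∷ v))
  zword-shuffleW-cons N a u b v = zword-prefix N b (shuffleW (a ∷ u) v)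
  zword-shuffleW-cons N a u a v = zword-prefix N a (shuffleW (a ∷ u) v ++ shuffleW u (a ∷ v) ++ scale ℚ.1ℚ (+ 1) (shuffleW u v))

  shuffle-aa-weight : ∀ s m → 1 ≤ m → m ℕ.< s → s ℕ.< n → ∀ U V →
    x s * (x m * U * V + (U * (x (s ℕ.∸ m) * V) + ħ * (U * V))) ≈ (x m * U) * (x (s ℕ.∸ m) * V)
  shuffle-aa-weight s m 1≤m m<s s<n U V = begin
    x s * (x m * U * V + (U * (x m′ * V) + ħ * (U * V)))
      ≈⟨ solve 6 (λ xs xm x′ U V h → xs :* (xm :* U :* V :+ (U :* (x′ :* V) :+ h :* (U :* V)))
                                    := (U :* V) :* (xs :* ((xm :+ x′) :+ h)))
                 refl (x s) (x m) (x m′) U V ħ ⟩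
    (U * V) * (x s * ((x m + x m′) + ħ))          ≡⟨ ≡.cong (λ t → (U * V) * (x t * ((x m + x m′) + ħ))) m+m′≡s ⟨
    (U * V) * (x (m ℕ.+ m′) * ((x m + x m′) + ħ))
      ≈⟨ *-congˡ (x*x≈x[m+p]*[x+x+ħ] m m′ 1≤m (ℕP.m<n⇒0<n∸m m<s) (ℕP.≤-trans (ℕP.≤-reflexive (≡.cong suc m+m′≡s)) s<n)) ⟨
    (U * V) * (x m * x m′)
      ≈⟨ solve 4 (λ U V a c → (U :* V) :* (a :* c) := (a :* U) :* (c :* V)) refl U V (x m) (x m′) ⟩
    (x m * U) * (x m′ * V)                        ∎
    where
    m′ = s ℕ.∸ m
    m+m′≡s : m ℕ.+ m′ ≡ s
    m+m′≡s = ℕP.m+[n∸m]≡n (ℕP.<⇒≤ m<s)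

  zword-shuffleW : ∀ {u v} → InĤ¹ u → InĤ¹ v → ∀ N → N ≤ n → eval (zword N) (shuffleW u v) ≈ zshuffle N u v
  zword-at-shuffleW : ∀ {h u d v} → InĤ¹ (h ∷ u) → InĤ¹ (d ∷ v) → ∀ s → 1 ≤ s → s ℕ.< n →
    eval (zword-at s) (shuffleW (h ∷ u) (d ∷ v)) ≈ zpair s (h ∷ u) (d ∷ v)

  zword-shuffleW {[]}    {v}     nil  v∈ N N≤n = eval-⟪⟫ (zword N) v
  zword-shuffleW {h ∷ u} {[]}    u∈   v∈ N N≤n =
    trans (eval-shuffleW-[] (h ∷ u) (zword N)) (sumBelow-cong′ N (λ m → sym (*-identityʳ _)))
  zword-shuffleW {h ∷ u} {d ∷ v} u∈   v∈ N N≤n = begin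
    eval (zword N) (shuffleW (h ∷ u) (d ∷ v))                     ≈⟨ zword-shuffleW-cons N h u d v ⟩
    sumBelow N (λ s → eval (zword-at s) (shuffleW (h ∷ u) (d ∷ v)))
      ≈⟨ sumBelow-cong N (λ s 1≤s s<N → zword-at-shuffleW u∈ v∈ s 1≤s (ℕP.<-≤-trans s<N N≤n)) ⟩
    sumBelow N (λ s → zpair s (h ∷ u) (d ∷ v))
      ≈⟨ sumBelow-Cauchy N (λ m → zword-at m (h ∷ u)) (λ m → zword-at m (d ∷ v)) ⟩
    zshuffle N (h ∷ u) (d ∷ v)                                    ∎

  zword-at-shuffleW {b} {[]} {d} {v} (b∷ u∈) v∈ s 1≤s s<n = begin
    eval (zword-at s) (prefix b (shuffleW [] (d ∷ v)))            ≈⟨ eval-prefix (zword-at s) b (shuffleW [] (d ∷ v)) ⟩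
    eval (zword s) (shuffleW [] (d ∷ v))                          ≈⟨ zword-shuffleW nil v∈ s (ℕP.<⇒≤ s<n) ⟩
    sumBelow s (λ m → zword-at m (d ∷ v))                         ≈⟨ sumBelow-reverse s _ ⟩
    sumBelow s (λ m → zword-at (s ℕ.∸ m) (d ∷ v))                 ≈⟨ sumBelow-cong′ s (λ m → *-identityˡ _) ⟨
    zpair s (b ∷ []) (d ∷ v)                                      ∎
  zword-at-shuffleW {b} {h ∷ u} {d} {v} (b∷ u∈) v∈ s 1≤s s<n = begin
    eval (zword-at s) (prefix b (shuffleW (h ∷ u) (d ∷ v)))       ≈⟨ eval-prefix (zword-at s) b (shuffleW (h ∷ u) (d ∷ v)) ⟩
    eval (zword s) (shuffleW (h ∷ u) (d ∷ v))                     ≈⟨ zword-shuffleW u∈ v∈ s (ℕP.<⇒≤ s<n) ⟩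
    zshuffle s (h ∷ u) (d ∷ v)
      ≈⟨ sumBelow-exchange s (λ i → zword-at i (h ∷ u)) (λ p → zword-at p (d ∷ v)) ⟩
    zpair s (b ∷ h ∷ u) (d ∷ v)                                   ∎
  zword-at-shuffleW {a} {h ∷ u} {b} {v} u∈ (b∷ v∈) s 1≤s s<n =
    trans (eval-prefix (zword-at s) b (shuffleW (a ∷ h ∷ u) v)) (zword-shuffleW u∈ v∈ s (ℕP.<⇒≤ s<n))
  zword-at-shuffleW {a} {h ∷ u} {a} {d ∷ v} (a∷ u∈) (a∷ v∈) s 1≤s s<n = begin
    eval (zword-at s) (prefix a L)                                ≈⟨ eval-prefix (zword-at s) a L ⟩
    eval (λ w → x s * zword-at s w) L
      ≈⟨ trans (eval-*ˡ (x s) (zword-at s) L)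
               (*-congˡ (trans (eval-++ (zword-at s) A (B ++ C′)) (+-congˡ (eval-++ (zword-at s) B C′)))) ⟩
    x s * (eval (zword-at s) A + (eval (zword-at s) B + eval (zword-at s) C′))
      ≈⟨ *-congˡ (+-cong (zword-at-shuffleW (a∷ u∈) v∈ s 1≤s s<n)
                 (+-cong (zword-at-shuffleW u∈ (a∷ v∈) s 1≤s s<n)
                         (trans (eval-scale (zword-at s) ℚ.1ℚ (+ 1) C)
                                (*-cong (trans (coef-1ℚ (+ 1)) (*-identityʳ ħ)) (zword-at-shuffleW u∈ v∈ s 1≤s s<n))))) ⟩
    x s * (zpair s (a ∷ h ∷ u) (d ∷ v) + (zpair s (h ∷ u) (a ∷ d ∷ v) + ħ * zpair s (h ∷ u) (d ∷ v)))
      ≈⟨ sumBelow-linear s (x s) ħ (λ m → x m * U m * V (s ℕ.∸ m)) (λ m → U m * (x (s ℕ.∸ m) * V (s ℕ.∸ m)))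
                         (λ m → U m * V (s ℕ.∸ m)) ⟩
    sumBelow s (λ m → x s * (x m * U m * V (s ℕ.∸ m) + (U m * (x (s ℕ.∸ m) * V (s ℕ.∸ m)) + ħ * (U m * V (s ℕ.∸ m)))))
      ≈⟨ sumBelow-cong s (λ m 1≤m m<s → shuffle-aa-weight s m 1≤m m<s s<n (U m) (V (s ℕ.∸ m))) ⟩
    zpair s (a ∷ h ∷ u) (a ∷ d ∷ v)                                ∎
    where
    A = shuffleW (a ∷ h ∷ u) (d ∷ v)
    B = shuffleW (h ∷ u) (a ∷ d ∷ v)
    C = shuffleW (h ∷ u) (d ∷ v)
    C′ = scale ℚ.1ℚ (+ 1) C
    L = A ++ B ++ C′
    U = λ m → zword-at m (h ∷ u)
    V = λ m → zword-at m (d ∷ v)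

  eval-wordIn𝔥-cong : ∀ 𝐤 {f g : List AB → Carrier} → (∀ w → InĤ¹ w → f w ≈ g w) → eval f (wordIn𝔥 𝐤) ≈ eval g (wordIn𝔥 𝐤)
  eval-wordIn𝔥-cong []      {f} {g} f≈g = trans (eval-⟪⟫ f []) (trans (f≈g [] nil) (sym (eval-⟪⟫ g [])))
  eval-wordIn𝔥-cong (k ∷ 𝐤) {f} {g} f≈g = begin
    eval f (wordIn𝔥 (k ∷ 𝐤))                                          ≈⟨ eval-wordIn𝔥-cons k 𝐤 f ⟩
    blockSum k (λ j → eval (λ v → f (aʷ j ++ b ∷ v)) (wordIn𝔥 𝐤))
      ≈⟨ blockSum-cong k (λ j → eval-wordIn𝔥-cong 𝐤 (λ v v∈ → f≈g (aʷ j ++ b ∷ v) (InĤ¹-block j v∈))) ⟩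
    blockSum k (λ j → eval (λ v → g (aʷ j ++ b ∷ v)) (wordIn𝔥 𝐤))     ≈⟨ eval-wordIn𝔥-cons k 𝐤 g ⟨
    eval g (wordIn𝔥 (k ∷ 𝐤))                                          ∎
    where
    InĤ¹-block : ∀ j {v} → InĤ¹ v → InĤ¹ (aʷ j ++ b ∷ v)
    InĤ¹-block zero          v∈ = b∷ v∈
    InĤ¹-block (suc zero)    v∈ = a∷ (b∷ v∈)
    InĤ¹-block (suc (suc j)) v∈ = a∷ (InĤ¹-block (suc j) v∈)

  -- Duality

  zsumWith : ℕ → Index → (ℕ → Carrier) → Carrier
  zsumWith N []      T = T N
  zsumWith N (k ∷ 𝐤) T = sumBelow N (λ m → Fk k m * zsumWith m 𝐤 T)

  zsum-++ : ∀ 𝐤 𝐥 N → zsum N (𝐤 ++ 𝐥) ≈ zsumWith N 𝐤 (λ m → zsum m 𝐥)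
  zsum-++ []      𝐥 N = refl
  zsum-++ (k ∷ 𝐤) 𝐥 N = sumBelow-cong′ N (λ m → *-congˡ (zsum-++ 𝐤 𝐥 m))

  zsumWith-++ : ∀ 𝐤 𝐥 N T → zsumWith N (𝐤 ++ 𝐥) T ≈ zsumWith N 𝐤 (λ m → zsumWith m 𝐥 T)
  zsumWith-++ []      𝐥 N T = refl
  zsumWith-++ (k ∷ 𝐤) 𝐥 N T = sumBelow-cong′ N (λ m → *-congˡ (zsumWith-++ 𝐤 𝐥 m T))

  zsumWith-cong : ∀ 𝐤 N → N ≤ n → ∀ {T T′} → (∀ m → m ≤ n → T m ≈ T′ m) → zsumWith N 𝐤 T ≈ zsumWith N 𝐤 T′
  zsumWith-cong []      N N≤n T≈T′ = T≈T′ N N≤n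
  zsumWith-cong (k ∷ 𝐤) N N≤n T≈T′ =
    sumBelow-cong N (λ m _ m<N → *-congˡ (zsumWith-cong 𝐤 m (ℕP.<⇒≤ (ℕP.<-≤-trans m<N N≤n)) T≈T′))

  zsumWith-eval : ∀ {Y : Set} 𝐤 N (g : ℕ → Y → Carrier) L →
    zsumWith N 𝐤 (λ m → eval (g m) L) ≈ eval (λ y → zsumWith N 𝐤 (λ m → g m y)) L
  zsumWith-eval []      N g L = refl
  zsumWith-eval (k ∷ 𝐤) N g L = begin
    sumBelow N (λ m → Fk k m * zsumWith m 𝐤 (λ m′ → eval (g m′) L))
      ≈⟨ sumBelow-cong′ N (λ m → *-congˡ (zsumWith-eval 𝐤 m g L)) ⟩
    sumBelow N (λ m → Fk k m * eval (λ y → zsumWith m 𝐤 (λ m′ → g m′ y)) L) ≈⟨ sumBelow-cong′ N (λ m → eval-*ˡ _ _ L) ⟨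
    sumBelow N (λ m → eval (λ y → Fk k m * zsumWith m 𝐤 (λ m′ → g m′ y)) L) ≈⟨ eval-sumBelow N _ L ⟨
    eval (λ y → zsumWith N (k ∷ 𝐤) (λ m → g m y)) L                       ∎

  zsum-convolution : Index → (ℕ → Carrier) → Carrier
  zsum-convolution []      T = T n
  zsum-convolution (k ∷ 𝐤) T = sumBelow n (λ m → Fk k m * zsum m 𝐤 * T (n ℕ.∸ m))

  zsumWith-ψletter : ∀ k T m → m ≤ n →
    eval (λ 𝐥 → zsumWith m 𝐥 T) (ext (λ j → ⟪ j ∷ [] ⟫) (ψletter k)) ≈ sumBelow m (λ l → Fk k (n ℕ.∸ l) * T l)
  zsumWith-ψletter k T m m≤n = begin
    eval (λ 𝐥 → zsumWith m 𝐥 T) (ext (λ j → ⟪ j ∷ [] ⟫) (ψletter k))  ≈⟨ eval-letters (λ 𝐥 → zsumWith m 𝐥 T) (ψletter k) ⟩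
    eval (λ j → sumBelow m (λ l → Fk j l * T l)) (ψletter k)         ≈⟨ eval-sumBelow m _ (ψletter k) ⟩
    sumBelow m (λ l → eval (λ j → Fk j l * T l) (ψletter k))
      ≈⟨ sumBelow-cong′ m (λ l → eval-*ʳ (T l) (λ j → Fk j l) (ψletter k)) ⟩
    sumBelow m (λ l → eval (λ j → Fk j l) (ψletter k) * T l)
      ≈⟨ sumBelow-cong m (λ l 1≤l l<m → *-congʳ (Reflection.Fk-ψletter l 1≤l (ℕP.<-≤-trans l<m m≤n) k)) ⟩
    sumBelow m (λ l → Fk k (n ℕ.∸ l) * T l)                           ∎

  zsum-convolution-cons : ∀ k 𝐤 T →
    zsum-convolution 𝐤 (λ m → sumBelow m (λ l → Fk k (n ℕ.∸ l) * T l)) ≈ zsum-convolution (k ∷ 𝐤) T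
  zsum-convolution-cons k [] T = begin
    sumBelow n (λ l → Fk k (n ℕ.∸ l) * T l)                        ≈⟨ sumBelow-reverse n _ ⟩
    sumBelow n (λ m → Fk k (n ℕ.∸ (n ℕ.∸ m)) * T (n ℕ.∸ m))
      ≈⟨ sumBelow-cong n (λ m _ m<n → *-congʳ (trans (reflexive (≡.cong (Fk k) (ℕP.m∸[m∸n]≡n (ℕP.<⇒≤ m<n))))
                                                     (sym (*-identityʳ _)))) ⟩
    sumBelow n (λ m → Fk k m * 1# * T (n ℕ.∸ m))                   ∎
  zsum-convolution-cons k (k′ ∷ 𝐤) T = begin
    sumBelow n (λ i → A i * sumBelow (n ℕ.∸ i) H)                  ≈⟨ sumBelow-exchange n A H ⟩
    sumBelow n (λ m → sumBelow m A * H (n ℕ.∸ m))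
      ≈⟨ sumBelow-cong n (λ m _ m<n → trans (*-congˡ (*-congʳ (reflexive (≡.cong (Fk k) (ℕP.m∸[m∸n]≡n (ℕP.<⇒≤ m<n))))))
                                              (solve 3 (λ z f t → z :* (f :* t) := f :* z :* t) refl _ _ _)) ⟩
    sumBelow n (λ m → Fk k m * zsum m (k′ ∷ 𝐤) * T (n ℕ.∸ m))       ∎
    where
    A = λ i → Fk k′ i * zsum i 𝐤
    H = λ l → Fk k (n ℕ.∸ l) * T l

  zsumWith-ψword : ∀ 𝐤 T → eval (λ 𝐱 → zsumWith n 𝐱 T) (ψword 𝐤) ≈ zsum-convolution 𝐤 T
  zsumWith-ψword []      T = eval-⟪⟫ (λ 𝐱 → zsumWith n 𝐱 T) []
  zsumWith-ψword (k ∷ 𝐤) T = begin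
    eval (λ 𝐱 → zsumWith n 𝐱 T) (ψword 𝐤 · Ψk)                          ≈⟨ eval-· _ (ψword 𝐤) Ψk ⟩
    eval (λ 𝐱 → eval (λ 𝐲 → zsumWith n (𝐱 ++ 𝐲) T) Ψk) (ψword 𝐤)
      ≈⟨ eval-cong (λ 𝐱 → eval-cong (λ 𝐲 → zsumWith-++ 𝐱 𝐲 n T) Ψk) (ψword 𝐤) ⟩
    eval (λ 𝐱 → eval (λ 𝐲 → zsumWith n 𝐱 (λ m → zsumWith m 𝐲 T)) Ψk) (ψword 𝐤)
      ≈⟨ eval-cong (λ 𝐱 → zsumWith-eval 𝐱 n (λ m 𝐲 → zsumWith m 𝐲 T) Ψk) (ψword 𝐤) ⟨
    eval (λ 𝐱 → zsumWith n 𝐱 (λ m → eval (λ 𝐲 → zsumWith m 𝐲 T) Ψk)) (ψword 𝐤)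
      ≈⟨ eval-cong (λ 𝐱 → zsumWith-cong 𝐱 n ℕP.≤-refl (zsumWith-ψletter k T)) (ψword 𝐤) ⟩
    eval (λ 𝐱 → zsumWith n 𝐱 T′) (ψword 𝐤)                              ≈⟨ zsumWith-ψword 𝐤 T′ ⟩
    zsum-convolution 𝐤 T′                                               ≈⟨ zsum-convolution-cons k 𝐤 T ⟩
    zsum-convolution (k ∷ 𝐤) T                                          ∎
    where
    Ψk = ext (λ j → ⟪ j ∷ [] ⟫) (ψletter k)
    T′ = λ m → sumBelow m (λ l → Fk k (n ℕ.∸ l) * T l)

  zshuffle-wordIn𝔥 : ∀ 𝐤 𝐥 →
    eval (λ u → eval (zshuffle n u) (wordIn𝔥 𝐥)) (wordIn𝔥 𝐤) ≈ zsum-convolution 𝐤 (λ m → zsum m 𝐥)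
  zshuffle-wordIn𝔥 []      𝐥 = trans (eval-⟪⟫ (λ u → eval (zshuffle n u) (wordIn𝔥 𝐥)) []) (zword-wordIn𝔥 𝐥 n ℕP.≤-refl)
  zshuffle-wordIn𝔥 (k ∷ 𝐤) 𝐥 = begin
    eval (λ u → eval (zshuffle n u) W′) (wordIn𝔥 (k ∷ 𝐤))
      ≈⟨ eval-wordIn𝔥-cons-cong k 𝐤 (λ j v → eval-cong (λ v′ → reflexive (zshuffle-block j v v′)) W′) ⟩
    eval (λ u → eval (λ v → sumBelow n (λ m → zword-at m u * zword (n ℕ.∸ m) v)) W′) (wordIn𝔥 (k ∷ 𝐤))
      ≈⟨ eval-cong (λ u → trans (eval-sumBelow n _ W′) (sumBelow-cong′ n (λ m → eval-*ˡ (zword-at m u) (zword (n ℕ.∸ m)) W′)))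
                   (wordIn𝔥 (k ∷ 𝐤)) ⟩
    eval (λ u → sumBelow n (λ m → zword-at m u * eval (zword (n ℕ.∸ m)) W′)) (wordIn𝔥 (k ∷ 𝐤))
      ≈⟨ eval-sumBelow n _ (wordIn𝔥 (k ∷ 𝐤)) ⟩
    sumBelow n (λ m → eval (λ u → zword-at m u * eval (zword (n ℕ.∸ m)) W′) (wordIn𝔥 (k ∷ 𝐤)))
      ≈⟨ sumBelow-cong′ n (λ m → eval-*ʳ _ (zword-at m) (wordIn𝔥 (k ∷ 𝐤))) ⟩
    sumBelow n (λ m → eval (zword-at m) (wordIn𝔥 (k ∷ 𝐤)) * eval (zword (n ℕ.∸ m)) W′)
      ≈⟨ sumBelow-cong n (λ m 1≤m m<n → *-cong (trans (zword-at-wordIn𝔥 k 𝐤 m 1≤m m<n)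
                                                      (*-congˡ (zword-wordIn𝔥 𝐤 m (ℕP.<⇒≤ m<n))))
                                                (zword-wordIn𝔥 𝐥 (n ℕ.∸ m) (ℕP.m∸n≤m n m))) ⟩
    zsum-convolution (k ∷ 𝐤) (λ m → zsum m 𝐥)                           ∎
    where
    W′ = wordIn𝔥 𝐥
    zshuffle-block : ∀ j v v′ →
      zshuffle n (aʷ j ++ b ∷ v) v′ ≡ sumBelow n (λ m → zword-at m (aʷ j ++ b ∷ v) * zword (n ℕ.∸ m) v′)
    zshuffle-block zero    v v′ = ≡.refl
    zshuffle-block (suc j) v v′ = ≡.refl

  zn-⧢Ĥ : ∀ w w′ → zn (w ⧢Ĥ w′) ≈ eval (λ 𝐤 → eval (λ 𝐥 → zsum-convolution 𝐤 (λ m → zsum m 𝐥)) w′) w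
  zn-⧢Ĥ w w′ = begin
    zn (w ⧢Ĥ w′)                                                     ≡⟨ zn≡eval (w ⧢Ĥ w′) ⟩
    eval zIndex (ext (expandW 0) (ι w ⧢q ι w′))                      ≈⟨ eval-ext zIndex (expandW 0) (ι w ⧢q ι w′) ⟩
    eval (λ u → eval (zsum n) (expandW 0 u)) (ι w ⧢q ι w′)
      ≈⟨ eval-cong (λ u → eval-zsum-expandW u 0 n ℕP.≤-refl) (ι w ⧢q ι w′) ⟩
    eval (zword n) (ext2 shuffleW (ι w) (ι w′))                      ≈⟨ eval-ext2 (zword n) shuffleW (ι w) (ι w′) ⟩
    eval (λ u → eval (λ v → Z u v) (ι w′)) (ι w)                     ≈⟨ eval-cong (λ u → eval-ext (Z u) wordIn𝔥 w′) (ι w) ⟩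
    eval (λ u → eval (λ 𝐥 → eval (Z u) (wordIn𝔥 𝐥)) w′) (ι w)        ≈⟨ eval-ext _ wordIn𝔥 w ⟩
    eval (λ 𝐤 → eval (λ u → eval (λ 𝐥 → eval (Z u) (wordIn𝔥 𝐥)) w′) (wordIn𝔥 𝐤)) w
      ≈⟨ eval-cong (λ 𝐤 → eval-comm (λ u 𝐥 → eval (Z u) (wordIn𝔥 𝐥)) (wordIn𝔥 𝐤) w′) w ⟩
    eval (λ 𝐤 → eval (λ 𝐥 → eval (λ u → eval (Z u) (wordIn𝔥 𝐥)) (wordIn𝔥 𝐤)) w′) w
      ≈⟨ eval-cong (λ 𝐤 → eval-cong (λ 𝐥 → shuffle 𝐤 𝐥) w′) w ⟩
    eval (λ 𝐤 → eval (λ 𝐥 → zsum-convolution 𝐤 (λ m → zsum m 𝐥)) w′) w ∎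
    where
    Z = λ u v → eval (zword n) (shuffleW u v)
    shuffle : ∀ 𝐤 𝐥 → eval (λ u → eval (Z u) (wordIn𝔥 𝐥)) (wordIn𝔥 𝐤) ≈ zsum-convolution 𝐤 (λ m → zsum m 𝐥)
    shuffle 𝐤 𝐥 = trans (eval-wordIn𝔥-cong 𝐤 (λ u u∈ → eval-wordIn𝔥-cong 𝐥 (λ v v∈ → zword-shuffleW u∈ v∈ n ℕP.≤-refl)))
                        (zshuffle-wordIn𝔥 𝐤 𝐥)

  zn-ψ· : ∀ w w′ → zn (ψ w · w′) ≈ eval (λ 𝐤 → eval (λ 𝐥 → zsum-convolution 𝐤 (λ m → zsum m 𝐥)) w′) w
  zn-ψ· w w′ = begin
    zn (ψ w · w′)                                                    ≡⟨ zn≡eval (ψ w · w′) ⟩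
    eval zIndex (ψ w · w′)                                           ≈⟨ eval-· zIndex (ψ w) w′ ⟩
    eval (λ 𝐱 → eval (λ 𝐥 → zsum n (𝐱 ++ 𝐥)) w′) (ψ w)              ≈⟨ eval-ext _ ψword w ⟩
    eval (λ 𝐤 → eval (λ 𝐱 → eval (λ 𝐥 → zsum n (𝐱 ++ 𝐥)) w′) (ψword 𝐤)) w
      ≈⟨ eval-cong (λ 𝐤 → eval-comm (λ 𝐱 𝐥 → zsum n (𝐱 ++ 𝐥)) (ψword 𝐤) w′) w ⟩
    eval (λ 𝐤 → eval (λ 𝐥 → eval (λ 𝐱 → zsum n (𝐱 ++ 𝐥)) (ψword 𝐤)) w′) w
      ≈⟨ eval-cong (λ 𝐤 → eval-cong (λ 𝐥 → eval-cong (λ 𝐱 → zsum-++ 𝐱 𝐥 n) (ψword 𝐤)) w′) w ⟩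
    eval (λ 𝐤 → eval (λ 𝐥 → eval (λ 𝐱 → zsumWith n 𝐱 (λ m → zsum m 𝐥)) (ψword 𝐤)) w′) w
      ≈⟨ eval-cong (λ 𝐤 → eval-cong (λ 𝐥 → zsumWith-ψword 𝐤 (λ m → zsum m 𝐥)) w′) w ⟩
    eval (λ 𝐤 → eval (λ 𝐥 → zsum-convolution 𝐤 (λ m → zsum m 𝐥)) w′) w ∎

theorem4p2 : {c ℓ : Level} (F : Field c ℓ) → Values.CharZero F →
    (n : ℕ) → 2 ≤ n → (ζ : Field.Carrier F) → Values.PrimitiveRoot F n ζ →
    let open Field F
        open Values.AtRoot F n ζ
    in ((w w' : Ĥ¹) → zn (w *q w') ≈ zn w * zn w')
       × ((w w' : Ĥ¹) → zn (w ⧢Ĥ w') ≈ zn (ψ w · w'))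
theorem4p2 F char0 n 2≤n ζ prim = zn-*q , λ w w′ → trans (zn-⧢Ĥ w w′) (sym (zn-ψ· w w′))
  where open AtPrimitiveRoot F char0 n 2≤n ζ prim
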